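{- Let $k$ be a field of characteristic zero. Let $\mathfrak SSym=\bigoplus_{n\ge0}\mathfrak SSym_n$ have basis $\{F_\sigma:\sigma\in\mathfrak S_n,\ n\ge0\}$ (with $\mathfrak S_0=\{\emptyset\}$) and product: for $\sigma\in\mathfrak S_q$, $\rho\in\mathfrak S_p$, $F_\sigma\cdot F_\rho=\sum F_w$, the sum over all shuffles $w$ of the words $\sigma_1\cdots\sigma_q$ and $(\rho_1+q)\cdots(\rho_p+q)$. Let $\mathcal MSym=k\oplus\bigoplus_{n\ge1}\mathrm{span}_k\{F_t:t\in\mathcal M_n\}$, where $1=F_{|}$ spans the degree-$0$ part. Define the action of $\mathfrak SSym$ on $\mathcal MSym$: for $w\in\mathfrak S_q$ ($q\ge0$) and $s\in\mathcal M_p\cup\{|\}$, put $b=\beta(w)$ (with $\beta(\emptyset)=|$) and $$F_w\cdot F_s=\sum_{b\to(b_0,b_1,\dots,b_p)}F_{(b_0,b_1,\dots,b_p)/s},$$ the sum over all $p$-splittings of $b$, where in the grafted tree: if $b_0$ has at least one node, all nodes originating in $s$ are circled and nodes originating in $b$ keep their circling from $b$; if $b_0$ has no node, all nodes originating in $b$ are uncircled and nodes originating in $s$ keep their circling from $s$. Define a product on $\mathcal MSym$ by the same formula: $F_a\cdot F_s=\sum_{a\to(a_0,\dots,a_p)}F_{(a_0,\dots,a_p)/s}$ for $a\in\mathcal M_q\cup\{|\}$, $s\in\mathcal M_p\cup\{|\}$, with the same circling rules. Then: (i) the action is associative, i.e. $(F_w\cdot F_v)\cdot x=F_w\cdot(F_v\cdot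 x)$ for all permutations $w,v$ and $x\in\mathcal MSym$; (ii) the product on $\mathcal MSym$ is associative; (iii) the linear map $\boldsymbol\beta:\mathfrak SSym\to\mathcal MSym$, $F_\sigma\mapsto F_{\beta(\sigma)}$ ($F_\emptyset\mapsto 1$), is an algebra homomorphism, and $\boldsymbol\phi\circ\boldsymbol\beta=\boldsymbol\tau$, where $\boldsymbol\tau:\mathfrak SSym\to\mathcal YSym$, $F_\sigma\mapsto F_{\tau(\sigma)}$ and $\boldsymbol\phi:\mathcal MSym\to\mathcal YSym$, $F_t\mapsto F_{\phi(t)}$ ($\mathcal YSym$ being the vector space with basis indexed by all planar binary trees).
   Context: A planar binary tree is either the leaf $|$ (no internal nodes) or an internal node (the root) together with an ordered pair $(L,R)$ of planar binary trees (left and right subtrees). A tree with $n$ internal nodes has $n+1$ leaves, numbered $0,\dots,n$ from left to right; its internal nodes are numbered $1,\dots,n$ in in-order (nodes of $L$, then the root, then nodes of $R$). The parent of a node is the node directly above it (root is topmost). Permutations as trees: $\sigma=\sigma_1\cdots\sigma_n\in\mathfrak S_n$ determines the decreasing binary tree: empty word gives $|$; otherwise the root is position $k$ with $\sigma_k=n$, its left subtree is built from $\sigma_1\cdots\sigma_{k-1}$ and its right subtree from $\sigma_{k+1}\cdots\sigma_n$ recursively; thus node $i$ carries label $\sigma_i$. $\tau(\sigma)$ is the underlying planar binary tree. A bi-leveled tree with $n\ge1$ nodes is a pair $(t,C)$ with $t$ a planar binary tree with $n$ internal nodes and $C\subseteq\{1,\dots,n\}$ (the circled nodes) such that node $1$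 is circled, no child of node $1$ is circled, and the parent of any circled node is circled. $\mathcal M_n$ is the set of these. $\phi(t,C)=t$. For $\sigma\in\mathfrak S_n$, $\beta(\sigma)=(\tau(\sigma),\{i:\sigma_i\ge\sigma_1\})$. Splittings: the $1$-splitting of a tree $t$ at leaf $i$ is the pair $(t_0,t_1)$ defined recursively: if $t=|$ it is $(|,|)$; if $t=(L,R)$ with $L$ having $k$ nodes, then if $i\le k$ split $L$ at $i$ into $(L_0,L_1)$ and return $(L_0,(L_1,R))$, while if $i>k$ split $R$ at $i-k-1$ into $(R_0,R_1)$ and return $((L,R_0),R_1)$. A $p$-splitting $t\to(t_0,\dots,t_p)$ is indexed by $0\le i_1\le\dots\le i_p\le n$: split $t$ at $i_1$ into $(t_0,t')$ and then take the $(p-1)$-splitting of $t'$ indexed by $i_2-i_1\le\dots\le i_p-i_1$ (a $0$-splitting of $t$ is $(t)$). Nodes keep their circling (for bi-leveled trees) under splitting. Grafting: for a tree $s$ with $p$ internal nodes, $(t_0,\dots,t_p)/s$ is obtained by replacing leaf $j$ of $s$ by $t_j$ for each $j$. -}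

module Defs where

open import Level using (Level; _⊔_; suc)
open import Algebra.Bundles using (CommutativeRing)
open import Data.Bool using (Bool; true; false; T; not)
open import Data.Unit using (⊤; tt)
open import Data.Empty using (⊥)
open import Data.Nat as ℕ using (ℕ; zero; _∸_; _≤ᵇ_; _≤?_)
open import Data.Product using (Σ; ∃; _×_; _,_; proj₁; proj₂)
open import Data.Sum using (_⊎_)
open import Data.List using (List; []; _∷_; [_]; _++_; map; concatMap; upTo; filter; length)
open import Data.List.Relation.Unary.All using (All)
open import Data.List.Relation.Binary.Permutation.Propositional using (_↭_)
import Data.List.Properties as LP
open import Relation.Nullary using (¬_; Dec; yes; no)
open import Relation.Binary.PropositionalEquality using (_≡_; refl; cong; cong₂)
open import Relation.Binary.Definitions using (DecidableEquality)
import Data.Bool.Properties as BP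

record Field (c ℓ : Level) : Set (Level.suc (c ⊔ ℓ)) where
  field
    commutativeRing : CommutativeRing c ℓ
  open CommutativeRing commutativeRing public
  field
    1≉0     : ¬ (1# ≈ 0#)
    inverse : ∀ x → ¬ (x ≈ 0#) → Σ Carrier λ y → (x * y) ≈ 1#

module _ {c ℓ} (F : Field c ℓ) where
  open Field F
  natF : ℕ → Carrier
  natF zero = 0#
  natF (ℕ.suc n) = 1# + natF n

CharZero : ∀ {c ℓ} → Field c ℓ → Set ℓ
CharZero F = ∀ n → Field._≈_ F (natF F n) (Field.0# F) → n ≡ 0

-- Planar binary trees, decorated at internal nodes.
-- node L a R : internal node with left subtree L, decoration a, right
-- subtree R; in-order numbering = nodes of L, root, nodes of R.

data BT (A : Set) : Set where
  leaf : BT A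
  node : BT A → A → BT A → BT A

mapBT : ∀ {A B : Set} → (A → B) → BT A → BT B
mapBT f leaf = leaf
mapBT f (node l a r) = node (mapBT f l) (f a) (mapBT f r)

size : ∀ {A : Set} → BT A → ℕ
size leaf = 0
size (node l a r) = size l ℕ.+ ℕ.suc (size r)

Tree : Set
Tree = BT ⊤

-- trees with circled (true) / uncircled (false) nodes
CTree : Set
CTree = BT Bool

rootCircled : CTree → Bool
rootCircled leaf = false
rootCircled (node l c r) = c

ParentClosed : CTree → Set
ParentClosed leaf = ⊤
ParentClosed (node l c r) =
  (T (rootCircled l) → T c) × (T (rootCircled r) → T c) × ParentClosed l × ParentClosed r

-- there is a node 1 (n ≥ 1), it is circled and no child of it is circled
-- (its left child is a leaf; its right child is the root of R)
Node1OK : CTree → Set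
Node1OK leaf = ⊥
Node1OK (node leaf c r) = T c × ¬ T (rootCircled r)
Node1OK (node (node l₁ c₁ r₁) c r) = Node1OK (node l₁ c₁ r₁)

-- bi-leveled trees: t ∈ 𝓜_n for n = size t ≥ 1
IsBiLeveled : CTree → Set
IsBiLeveled t = Node1OK t × ParentClosed t

InMBasis : CTree → Set
InMBasis t = t ≡ leaf ⊎ IsBiLeveled t

φ : CTree → Tree
φ = mapBT (λ _ → tt)

-- Permutations as words σ₁⋯σₙ (one-line notation) with values 1..n

IsPerm : List ℕ → Set
IsPerm w = w ↭ map ℕ.suc (upTo (length w))

maxL : List ℕ → ℕ
maxL [] = 0
maxL (x ∷ xs) = ℕ._⊔_ x (maxL xs)

splitAtVal : ℕ → List ℕ → List ℕ × List ℕ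
splitAtVal m [] = [] , []
splitAtVal m (x ∷ xs) with x ℕ.≟ m
... | yes _ = [] , xs
... | no _  = let (p , s) = splitAtVal m xs in (x ∷ p) , s

-- decreasing binary tree of a word, nodes labelled by their letters.
-- The fuel argument (≥ length of the word) only ensures termination.
decTreeF : ℕ → List ℕ → BT ℕ
decTreeF zero _ = leaf
decTreeF (ℕ.suc k) [] = leaf
decTreeF (ℕ.suc k) (x ∷ xs) =
  let m = maxL (x ∷ xs)
      (p , s) = splitAtVal m (x ∷ xs)
  in node (decTreeF k p) m (decTreeF k s)

decTree : List ℕ → BT ℕ
decTree w = decTreeF (length w) w

τ : List ℕ → Tree
τ w = mapBT (λ _ → tt) (decTree w)

-- β(σ) = (τ(σ), {i : σ_i ≥ σ_1}); β(∅) = |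
β : List ℕ → CTree
β [] = leaf
β (σ₁ ∷ w) = mapBT (λ v → σ₁ ≤ᵇ v) (decTree (σ₁ ∷ w))

shuffles : List ℕ → List ℕ → List (List ℕ)
shuffles [] ys = [ ys ]
shuffles (x ∷ xs) [] = [ x ∷ xs ]
shuffles (x ∷ xs) (y ∷ ys) =
  map (x ∷_) (shuffles xs (y ∷ ys)) ++ map (y ∷_) (shuffles (x ∷ xs) ys)

permProd : List ℕ → List ℕ → List (List ℕ)
permProd σ ρ = shuffles σ (map (length σ ℕ.+_) ρ)

split1 : ∀ {A : Set} → ℕ → BT A → BT A × BT A
split1 i leaf = leaf , leaf
split1 i (node l a r) with i ≤? size l
... | yes _ = let (l₀ , l₁) = split1 i l in l₀ , node l₁ a r
... | no _  = let (r₀ , r₁) = split1 (i ∸ size l ∸ 1) r in node l a r₀ , r₁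

-- p-splitting indexed by i₁ ≤ ⋯ ≤ i_p  (given as the list i₁ ∷ ⋯ ∷ i_p).
-- pSplitFrom o is t : the splitting of t indexed by (i₁ ∸ o) ≤ ⋯ ≤ (i_p ∸ o),
-- i.e. split t at i₁ ∸ o, then recurse with base i₁ on the remaining indices
-- (for nondecreasing sequences (i_k ∸ o) ∸ (i₁ ∸ o) = i_k ∸ i₁).
pSplitFrom : ∀ {A : Set} → ℕ → List ℕ → BT A → List (BT A)
pSplitFrom o [] t = [ t ]
pSplitFrom o (i ∷ is) t =
  let (t₀ , t′) = split1 (i ∸ o) t in t₀ ∷ pSplitFrom i is t′

pSplit : ∀ {A : Set} → List ℕ → BT A → List (BT A)
pSplit = pSplitFrom 0

ndSeqs : ℕ → ℕ → ℕ → List (List ℕ)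
ndSeqs zero lo n = [ [] ]
ndSeqs (ℕ.suc p) lo n =
  concatMap (λ i → map (i ∷_) (ndSeqs p i n)) (filter (lo ≤?_) (upTo (ℕ.suc n)))

splittings : ∀ {A : Set} → ℕ → BT A → List (List (BT A))
splittings p t = map (λ is → pSplit is t) (ndSeqs p 0 (size t))

graftAux : ∀ {A : Set} → BT A → List (BT A) → BT A × List (BT A)
graftAux leaf [] = leaf , []
graftAux leaf (t ∷ ts) = t , ts
graftAux (node l a r) ts =
  let (l′ , ts₁) = graftAux l ts
      (r′ , ts₂) = graftAux r ts₁
  in node l′ a r′ , ts₂

graft : ∀ {A : Set} → List (BT A) → BT A → BT A
graft ts s = proj₁ (graftAux s ts)

graftCircled : List CTree → CTree → CTree
graftCircled [] s = graft [] s
graftCircled (b₀ ∷ bs) s with size b₀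
... | zero    = graft (map (mapBT (λ _ → false)) (b₀ ∷ bs)) s
... | ℕ.suc _ = graft (b₀ ∷ bs) (mapBT (λ _ → true) s)

treeProd : CTree → CTree → List CTree
treeProd a s = map (λ bs → graftCircled bs s) (splittings (size s) a)

bt-≟ : DecidableEquality (BT Bool)
bt-≟ leaf leaf = yes refl
bt-≟ leaf (node _ _ _) = no λ ()
bt-≟ (node _ _ _) leaf = no λ ()
bt-≟ (node l a r) (node l′ a′ r′) with bt-≟ l l′ | BP._≟_ a a′ | bt-≟ r r′
... | yes refl | yes refl | yes refl = yes refl
... | no ne | _ | _ = no λ { refl → ne refl }
... | yes _ | no ne | _ = no λ { refl → ne refl }
... | yes _ | yes _ | no ne = no λ { refl → ne refl }

tree-≟ : DecidableEquality Tree
tree-≟ leaf leaf = yes refl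
tree-≟ leaf (node _ _ _) = no λ ()
tree-≟ (node _ _ _) leaf = no λ ()
tree-≟ (node l tt r) (node l′ tt r′) with tree-≟ l l′ | tree-≟ r r′
... | yes refl | yes refl = yes refl
... | no ne | _ = no λ { refl → ne refl }
... | yes _ | no ne = no λ { refl → ne refl }

word-≟ : DecidableEquality (List ℕ)
word-≟ = LP.≡-dec ℕ._≟_

-- Vector spaces with a basis B over the field: finite formal linear
-- combinations, compared coefficientwise.

module Lin {c ℓ} (F : Field c ℓ) where
  open Field F

  LC : Set → Set c
  LC B = List (Carrier × B)

  coeff : ∀ {B : Set} → DecidableEquality B → LC B → B → Carrier
  coeff _≟B_ [] b = 0#
  coeff _≟B_ ((x , b′) ∷ xs) b with b′ ≟B b
  ... | yes _ = x + coeff _≟B_ xs b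
  ... | no _  = coeff _≟B_ xs b

  Eq : ∀ {B : Set} → DecidableEquality B → LC B → LC B → Set ℓ
  Eq _≟B_ u v = ∀ b → coeff _≟B_ u b ≈ coeff _≟B_ v b

  basis : ∀ {B : Set} → B → LC B
  basis b = [ (1# , b) ]

  linMap : ∀ {B C : Set} → (B → LC C) → LC B → LC C
  linMap f = concatMap (λ { (x , b) → map (λ { (y , c′) → (x * y , c′) }) (f b) })

  bilin : ∀ {B C D : Set} → (B → C → List D) → LC B → LC C → LC D
  bilin f u v =
    concatMap (λ { (x , b) →
      concatMap (λ { (y , c′) → map (λ d → (x * y , d)) (f b c′) }) v }) u

  SSym : Set c
  SSym = LC (List ℕ)

  InSSym : SSym → Set c
  InSSym u = All (λ p → IsPerm (proj₂ p)) u

  _≈S_ : SSym → SSym → Set ℓ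
  _≈S_ = Eq word-≟

  _·S_ : SSym → SSym → SSym
  _·S_ = bilin permProd

  oneS : SSym
  oneS = basis []

  MSym : Set c
  MSym = LC CTree

  InMSym : MSym → Set c
  InMSym u = All (λ p → InMBasis (proj₂ p)) u

  _≈M_ : MSym → MSym → Set ℓ
  _≈M_ = Eq bt-≟

  _·M_ : MSym → MSym → MSym
  _·M_ = bilin treeProd

  oneM : MSym
  oneM = basis leaf

  YSym : Set c
  YSym = LC Tree

  _≈Y_ : YSym → YSym → Set ℓ
  _≈Y_ = Eq tree-≟

  βL : SSym → MSym
  βL = linMap (λ σ → basis (β σ))

  τL : SSym → YSym
  τL = linMap (λ σ → basis (τ σ))

  φL : MSym → YSym
  φL = linMap (λ t → basis (φ t))

  _▷_ : SSym → MSym → MSym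
  _▷_ = bilin (λ w s → treeProd (β w) s)

module Submission where

-- Every operation in the statement is the (bi)linear extension, via Lin.linMap
-- and Lin.bilin, of an operation on basis elements returning a LIST of basis
-- elements.  Associativity and the homomorphism property of such extensions
-- only depend on the basis-level lists agreeing UP TO REORDERING (_↭_), since
-- the coefficients of a formal sum do not see the order of its terms
-- (module Linear).  Everything therefore reduces to three combinatorial facts:
--
--  (A) the shuffle product of words is associative up to reordering
--      (module Shuffle);
--  (B) β turns shuffle products into the tree products of 𝓜Sym:
--      map β (permProd σ ρ) ↭ treeProd (β σ) (β ρ)
--      (modules Splitting, Grafting, DecTree and BetaProduct);
--      this rests on the decreasing-tree description of shuffles: the
--      decreasing trees of the shuffles of A with B are exactly the graftings
--      of the splittings of decTree A onto decTree B when all letters of A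
--      are smaller than those of B;
--  (C) β maps permutations onto the basis of 𝓜Sym: β(σ) is bi-leveled and
--      every bi-leveled tree is some β(σ) (modules BetaBasis, BetaSurjective).

open import Defs
open import Level using (Level)
open import Data.List using (List; [])
open import Data.Nat using (ℕ)
open import Data.Product using (_×_)

-- Reordering lemmas for concatMap: the list-level shadow of bilinearity.
module PermLemmas where

  open import Data.List using (List; []; _∷_; [_]; _++_; map; concatMap)
  open import Data.List.Properties using (++-assoc; concatMap-++)
  open import Data.List.Membership.Propositional using (_∈_)
  open import Data.List.Relation.Unary.Any using (here; there)
  open import Data.List.Relation.Binary.Permutation.Propositional
    using (_↭_; prep; swap; ↭-refl; ↭-sym; ↭-trans; module PermutationReasoning)
  open import Data.List.Relation.Binary.Permutation.Propositional.Properties using (++⁺; ++⁺ˡ; shifts)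
  open import Relation.Binary.PropositionalEquality using (_≡_; refl; sym; trans; cong; cong₂)
  open import Data.List.Properties public using (concatMap-map; map-concatMap; concatMap-pure)

  private variable
    ℓa ℓb ℓc : Level
    A : Set ℓa
    B : Set ℓb
    C : Set ℓc

  ≡⇒↭ : {xs ys : List A} → xs ≡ ys → xs ↭ ys
  ≡⇒↭ refl = ↭-refl

  concatMap-↭-local : {f g : A → List B} (xs : List A) →
    (∀ {x} → x ∈ xs → f x ↭ g x) → concatMap f xs ↭ concatMap g xs
  concatMap-↭-local [] h = ↭-refl
  concatMap-↭-local (x ∷ xs) h = ++⁺ (h (here refl)) (concatMap-↭-local xs (λ p → h (there p)))

  concatMap-↭ : {f g : A → List B} (xs : List A) → (∀ x → f x ↭ g x) → concatMap f xs ↭ concatMap g xs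
  concatMap-↭ xs h = concatMap-↭-local xs (λ {x} _ → h x)

  concatMap-resp-↭ : (f : A → List B) {xs ys : List A} → xs ↭ ys → concatMap f xs ↭ concatMap f ys
  concatMap-resp-↭ f _↭_.refl = ↭-refl
  concatMap-resp-↭ f (prep x p) = ++⁺ˡ (f x) (concatMap-resp-↭ f p)
  concatMap-resp-↭ f (swap x y p) =
    ↭-trans (shifts (f x) (f y)) (++⁺ˡ (f y) (++⁺ˡ (f x) (concatMap-resp-↭ f p)))
  concatMap-resp-↭ f (_↭_.trans p q) = ↭-trans (concatMap-resp-↭ f p) (concatMap-resp-↭ f q)

  concatMap-++-split : (f g : A → List B) (xs : List A) →
    concatMap (λ x → f x ++ g x) xs ↭ concatMap f xs ++ concatMap g xs
  concatMap-++-split f g [] = ↭-refl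
  concatMap-++-split f g (x ∷ xs) = begin
      (f x ++ g x) ++ concatMap (λ x → f x ++ g x) xs   ↭⟨ ≡⇒↭ (++-assoc (f x) (g x) _) ⟩
      f x ++ (g x ++ concatMap (λ x → f x ++ g x) xs)   ↭⟨ ++⁺ˡ (f x) (++⁺ˡ (g x) (concatMap-++-split f g xs)) ⟩
      f x ++ (g x ++ (concatMap f xs ++ concatMap g xs)) ↭⟨ ++⁺ˡ (f x) (shifts (g x) (concatMap f xs)) ⟩
      f x ++ (concatMap f xs ++ (g x ++ concatMap g xs)) ↭⟨ ≡⇒↭ (sym (++-assoc (f x) _ _)) ⟩
      (f x ++ concatMap f xs) ++ (g x ++ concatMap g xs) ∎
    where open PermutationReasoning

  concatMap-concatMap : (g : B → List C) (f : A → List B) (xs : List A) →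
    concatMap g (concatMap f xs) ≡ concatMap (λ x → concatMap g (f x)) xs
  concatMap-concatMap g f [] = refl
  concatMap-concatMap g f (x ∷ xs) =
    trans (concatMap-++ g (f x) (concatMap f xs)) (cong (concatMap g (f x) ++_) (concatMap-concatMap g f xs))

  concatMap-singleton : (f : A → B) (xs : List A) → concatMap (λ x → [ f x ]) xs ≡ map f xs
  concatMap-singleton f [] = refl
  concatMap-singleton f (x ∷ xs) = cong (f x ∷_) (concatMap-singleton f xs)

  map-cong-∈ : {f g : A → B} (xs : List A) → (∀ {x} → x ∈ xs → f x ≡ g x) → map f xs ≡ map g xs
  map-cong-∈ [] h = refl
  map-cong-∈ (x ∷ xs) h = cong₂ _∷_ (h (here refl)) (map-cong-∈ xs (λ p → h (there p)))

  concatMap-cong-local : {f g : A → List B} (xs : List A) →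
    (∀ {x} → x ∈ xs → f x ≡ g x) → concatMap f xs ≡ concatMap g xs
  concatMap-cong-local [] h = refl
  concatMap-cong-local (x ∷ xs) h = cong₂ _++_ (h (here refl)) (concatMap-cong-local xs (λ p → h (there p)))

module Linear where

  open PermLemmas
  open import Data.Product using (_×_; _,_; proj₂)
  open import Data.List using (List; []; _∷_; [_]; _++_; map; concatMap)
  open import Data.List.Properties using (concatMap-++; concatMap-cong; ++-identityʳ; map-∘)
  open import Data.List.Relation.Unary.All using (All; []; _∷_)
  import Data.List.Relation.Unary.All.Properties as AllP
  open import Data.List.Relation.Binary.Permutation.Propositional using (_↭_; prep; swap; ↭-trans)
  import Data.List.Relation.Binary.Permutation.Propositional.Properties as PermP
  open import Relation.Nullary using (yes; no)
  open import Relation.Binary.Definitions using (DecidableEquality)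
  -- qualified, since the field's own refl/sym/trans (for ≈) are opened below
  import Relation.Binary.PropositionalEquality as P
  open P using (_≡_)

  Supported : ∀ {c} {K : Set c} {B : Set} → (B → Set) → List (K × B) → Set c
  Supported P u = All (λ p → P (proj₂ p)) u

  module OverField {c ℓ} (F : Field c ℓ) where
    open Field F
    open Lin F

    module _ {B : Set} (_≟B_ : DecidableEquality B) where

      -- coefficientwise equality, wrapped in a record so that the two
      -- combinations stay inferable (Eq itself unfolds to a Π-type)
      record CoeffEq (u v : LC B) : Set ℓ where
        constructor coeffEq
        field coeffs : Eq _≟B_ u v
      open CoeffEq public

      CoeffEq-refl : ∀ {u} → CoeffEq u u
      CoeffEq-refl = coeffEq λ b → refl

      CoeffEq-trans : ∀ {u v w} → CoeffEq u v → CoeffEq v w → CoeffEq u w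
      CoeffEq-trans p q = coeffEq λ b → trans (coeffs p b) (coeffs q b)

      CoeffEq-≡ : ∀ {u v : LC B} → u ≡ v → CoeffEq u v
      CoeffEq-≡ P.refl = CoeffEq-refl

      coeff-++ : ∀ (u v : LC B) b → coeff _≟B_ (u ++ v) b ≈ coeff _≟B_ u b + coeff _≟B_ v b
      coeff-++ [] v b = sym (+-identityˡ _)
      coeff-++ ((x , b′) ∷ u) v b with b′ ≟B b
      ... | yes _ = trans (+-congˡ (coeff-++ u v b)) (sym (+-assoc _ _ _))
      ... | no _ = coeff-++ u v b

      CoeffEq-++ : ∀ {u u′ v v′ : LC B} → CoeffEq u u′ → CoeffEq v v′ → CoeffEq (u ++ v) (u′ ++ v′)
      CoeffEq-++ {u} {u′} {v} {v′} p q = coeffEq λ b →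
        trans (coeff-++ u v b) (trans (+-cong (coeffs p b) (coeffs q b)) (sym (coeff-++ u′ v′ b)))

      CoeffEq-↭ : ∀ {u v : LC B} → u ↭ v → CoeffEq u v
      CoeffEq-↭ p = coeffEq (coeffs-↭ p)
        where
        coeffs-↭ : ∀ {u v : LC B} → u ↭ v → Eq _≟B_ u v
        coeffs-↭ _↭_.refl b = refl
        coeffs-↭ (prep p xs) b =
          trans (coeff-++ [ p ] _ b) (trans (+-congˡ (coeffs-↭ xs b)) (sym (coeff-++ [ p ] _ b)))
        coeffs-↭ {u = p ∷ q ∷ xs} {v = q ∷ p ∷ ys} (swap _ _ r) b =
          trans (unfold p q xs) (trans (+-swap (coeffs-↭ r b)) (sym (unfold q p ys)))
          where
          unfold : ∀ p q xs → coeff _≟B_ (p ∷ q ∷ xs) b ≈ coeff _≟B_ [ p ] b + (coeff _≟B_ [ q ] b + coeff _≟B_ xs b)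
          unfold p q xs = trans (coeff-++ [ p ] (q ∷ xs) b) (+-congˡ (coeff-++ [ q ] xs b))
          +-swap : ∀ {x y z z′} → z ≈ z′ → x + (y + z) ≈ y + (x + z′)
          +-swap {x} {y} {z} {z′} z≈z′ = begin
            x + (y + z)  ≈⟨ sym (+-assoc x y z) ⟩
            (x + y) + z  ≈⟨ +-cong (+-comm x y) z≈z′ ⟩
            (y + x) + z′ ≈⟨ +-assoc y x z′ ⟩
            y + (x + z′) ∎
            where open import Relation.Binary.Reasoning.Setoid setoid
        coeffs-↭ (_↭_.trans p q) b = trans (coeffs-↭ p b) (coeffs-↭ q b)

      CoeffEq-scalar : ∀ {D : Set} (ds : List D) (h : D → B) (s t : Carrier) → s ≈ t →
        CoeffEq (map (λ d → (s , h d)) ds) (map (λ d → (t , h d)) ds)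
      CoeffEq-scalar ds h s t st = coeffEq (go ds)
        where
        go : ∀ ds → Eq _≟B_ (map (λ d → (s , h d)) ds) (map (λ d → (t , h d)) ds)
        go [] b = refl
        go (d ∷ ds) b with h d ≟B b
        ... | yes _ = +-cong st (go ds b)
        ... | no _ = go ds b

    bilin-[]ʳ : ∀ {B C D : Set} (f : B → C → List D) (u : LC B) → bilin f u [] ≡ []
    bilin-[]ʳ f [] = P.refl
    bilin-[]ʳ f (x ∷ u) = bilin-[]ʳ f u

    bilin-++ʳ : ∀ {B C D : Set} (f : B → C → List D) (u : LC B) (v v′ : LC C) →
      bilin f u (v ++ v′) ↭ bilin f u v ++ bilin f u v′
    bilin-++ʳ f u v v′ = ↭-trans (≡⇒↭ (distribute u)) (concatMap-++-split _ _ u)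
      where
      distribute : (u : LC _) → bilin f u (v ++ v′) ≡
        concatMap (λ { (x , b) → concatMap (λ { (y , c′) → map (λ d → (x * y , d)) (f b c′) }) v
                              ++ concatMap (λ { (y , c′) → map (λ d → (x * y , d)) (f b c′) }) v′ }) u
      distribute [] = P.refl
      distribute ((x , b) ∷ u) = P.cong₂ _++_ (concatMap-++ _ v v′) (distribute u)

    termProd : ∀ {A B D : Set} → (A → B → List D) → Carrier → A → Carrier → B → LC D
    termProd f x a y b = map (λ d → (x * y , d)) (f a b)

    -- the product of the term x·a with the combination Y;
    -- bilin f ((x , a) ∷ X) Y unfolds to termTimes f x a Y ++ bilin f X Y
    termTimes : ∀ {A B D : Set} → (A → B → List D) → Carrier → A → LC B → LC D
    termTimes f x a Y = concatMap (λ { (y , b) → termProd f x a y b }) Y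

    module _ {A B C D G H : Set} (_≟H_ : DecidableEquality H)
      (f₁ : A → B → List D) (f₃ : D → C → List H) (f₂ : B → C → List G) (f₄ : A → G → List H)
      (PA : A → Set) (PB : B → Set) (PC : C → Set)
      (basis-assoc : ∀ a b c → PA a → PB b → PC c →
         concatMap (λ t → f₃ t c) (f₁ a b) ↭ concatMap (λ t → f₄ a t) (f₂ b c)) where

      private
        _≋_ = CoeffEq _≟H_
        ≋-trans = CoeffEq-trans _≟H_
        ≋-≡ = CoeffEq-≡ _≟H_

      -- three single terms: basis-assoc together with (xy)z = x(yz)
      bilin-assoc-terms : ∀ x a y b z c → PA a → PB b → PC c →
        bilin f₃ (termProd f₁ x a y b) [ (z , c) ] ≋ termTimes f₄ x a (termProd f₂ y b z c)
      bilin-assoc-terms x a y b z c pa pb pc =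
        ≋-trans (≋-≡ (P.trans left (P.sym (map-concatMap xy-z (λ t → f₃ t c) (f₁ a b)))))
        (≋-trans (CoeffEq-↭ _≟H_ (PermP.map⁺ xy-z (basis-assoc a b c pa pb pc)))
        (≋-trans (CoeffEq-scalar _≟H_ (concatMap (f₄ a) (f₂ b c)) (λ e → e) _ _ (*-assoc x y z))
        (≋-≡ (P.trans (map-concatMap x-yz (f₄ a) (f₂ b c)) (P.sym (concatMap-map _ (λ g → (y * z , g)) (f₂ b c)))))))
        where
        xy-z = λ e → ((x * y) * z , e)
        x-yz = λ e → (x * (y * z) , e)
        left : bilin f₃ (termProd f₁ x a y b) [ (z , c) ] ≡ concatMap (λ t → map xy-z (f₃ t c)) (f₁ a b)
        left = P.trans (concatMap-map _ (λ t → (x * y , t)) (f₁ a b))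
                       (concatMap-cong (λ t → ++-identityʳ (map xy-z (f₃ t c))) (f₁ a b))

      bilin-assoc-terms₂ : ∀ x a y b → PA a → PB b → (Z : LC C) → Supported PC Z →
        bilin f₃ (termProd f₁ x a y b) Z ≋ termTimes f₄ x a (termTimes f₂ y b Z)
      bilin-assoc-terms₂ x a y b pa pb [] _ = ≋-≡ (bilin-[]ʳ f₃ (termProd f₁ x a y b))
      bilin-assoc-terms₂ x a y b pa pb ((z , c) ∷ Z) (pc ∷ pZ) =
        ≋-trans (CoeffEq-↭ _≟H_ (bilin-++ʳ f₃ (termProd f₁ x a y b) [ (z , c) ] Z))
        (≋-trans (CoeffEq-++ _≟H_ (bilin-assoc-terms x a y b z c pa pb pc) (bilin-assoc-terms₂ x a y b pa pb Z pZ))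
        (≋-≡ (P.sym (concatMap-++ _ (termProd f₂ y b z c) (termTimes f₂ y b Z)))))

      bilin-assoc-terms₁ : ∀ x a → PA a → (Y : LC B) → Supported PB Y → (Z : LC C) → Supported PC Z →
        bilin f₃ (termTimes f₁ x a Y) Z ≋ termTimes f₄ x a (bilin f₂ Y Z)
      bilin-assoc-terms₁ x a pa [] _ Z pZ = CoeffEq-refl _≟H_
      bilin-assoc-terms₁ x a pa ((y , b) ∷ Y) (pb ∷ pY) Z pZ =
        ≋-trans (≋-≡ (concatMap-++ _ (termProd f₁ x a y b) (termTimes f₁ x a Y)))
        (≋-trans (CoeffEq-++ _≟H_ (bilin-assoc-terms₂ x a y b pa pb Z pZ) (bilin-assoc-terms₁ x a pa Y pY Z pZ))
        (≋-≡ (P.sym (concatMap-++ _ (termTimes f₂ y b Z) (bilin f₂ Y Z)))))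

      bilin-assoc : (X : LC A) → Supported PA X → (Y : LC B) → Supported PB Y → (Z : LC C) → Supported PC Z →
        bilin f₃ (bilin f₁ X Y) Z ≋ bilin f₄ X (bilin f₂ Y Z)
      bilin-assoc [] _ Y pY Z pZ = CoeffEq-refl _≟H_
      bilin-assoc ((x , a) ∷ X) (pa ∷ pX) Y pY Z pZ =
        ≋-trans (≋-≡ (concatMap-++ _ (termTimes f₁ x a Y) (bilin f₁ X Y)))
        (CoeffEq-++ _≟H_ (bilin-assoc-terms₁ x a pa Y pY Z pZ) (bilin-assoc X pX Y pY Z pZ))

    module _ {A B D A′ B′ D′ : Set} (_≟D_ : DecidableEquality D′)
      (f : A → B → List D) (f′ : A′ → B′ → List D′)
      (gA : A → A′) (gB : B → B′) (gD : D → D′)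
      (PA : A → Set) (PB : B → Set)
      (basis-hom : ∀ a b → PA a → PB b → map gD (f a b) ↭ f′ (gA a) (gB b)) where

      private
        _≋_ = CoeffEq _≟D_
        ≋-trans = CoeffEq-trans _≟D_
        ≋-≡ = CoeffEq-≡ _≟D_
        linD = linMap (λ d → basis (gD d))

      -- two single terms: basis-hom together with (xy)·1 = (x·1)(y·1)
      bilin-hom-terms : ∀ x a y b → PA a → PB b →
        linD (termProd f x a y b) ≋ termProd f′ (x * 1#) (gA a) (y * 1#) (gB b)
      bilin-hom-terms x a y b pa pb =
        ≋-trans (≋-≡ (P.trans (concatMap-map _ (λ d → (x * y , d)) (f a b))
                   (P.trans (concatMap-singleton (λ d → ((x * y) * 1# , gD d)) (f a b))
                            (map-∘ {g = λ e → ((x * y) * 1# , e)} {f = gD} (f a b)))))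
        (≋-trans (CoeffEq-↭ _≟D_ (PermP.map⁺ (λ e → ((x * y) * 1# , e)) (basis-hom a b pa pb)))
                 (CoeffEq-scalar _≟D_ (f′ (gA a) (gB b)) (λ e → e) _ _ units))
        where
        units : ((x * y) * 1#) ≈ ((x * 1#) * (y * 1#))
        units = trans (*-identityʳ _) (sym (*-cong (*-identityʳ x) (*-identityʳ y)))

      bilin-hom-terms₁ : ∀ x a → PA a → (Y : LC B) → Supported PB Y →
        linD (termTimes f x a Y) ≋ termTimes f′ (x * 1#) (gA a) (linMap (λ b → basis (gB b)) Y)
      bilin-hom-terms₁ x a pa [] _ = CoeffEq-refl _≟D_
      bilin-hom-terms₁ x a pa ((y , b) ∷ Y) (pb ∷ pY) =
        ≋-trans (≋-≡ (concatMap-++ _ (termProd f x a y b) _))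
        (CoeffEq-++ _≟D_ (bilin-hom-terms x a y b pa pb) (bilin-hom-terms₁ x a pa Y pY))

      bilin-hom : (X : LC A) → Supported PA X → (Y : LC B) → Supported PB Y →
        linD (bilin f X Y) ≋ bilin f′ (linMap (λ a → basis (gA a)) X) (linMap (λ b → basis (gB b)) Y)
      bilin-hom [] _ Y pY = CoeffEq-refl _≟D_
      bilin-hom ((x , a) ∷ X) (pa ∷ pX) Y pY =
        ≋-trans (≋-≡ (concatMap-++ _ (termTimes f x a Y) _))
        (CoeffEq-++ _≟D_ (bilin-hom-terms₁ x a pa Y pY) (bilin-hom X pX Y pY))

    linMap-comp : ∀ {A B C : Set} (_≟C_ : DecidableEquality C) (g₁ : A → B) (g₂ : B → C) (g₃ : A → C) →
      (∀ a → g₂ (g₁ a) ≡ g₃ a) → (X : LC A) →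
      CoeffEq _≟C_ (linMap (λ b → basis (g₂ b)) (linMap (λ a → basis (g₁ a)) X)) (linMap (λ a → basis (g₃ a)) X)
    linMap-comp _≟C_ g₁ g₂ g₃ h [] = CoeffEq-refl _≟C_
    linMap-comp _≟C_ g₁ g₂ g₃ h ((x , a) ∷ X) =
      CoeffEq-++ _≟C_
        (CoeffEq-trans _≟C_ (CoeffEq-scalar _≟C_ [ a ] (λ a → g₂ (g₁ a)) _ _ (*-identityʳ _))
                            (CoeffEq-≡ _≟C_ (P.cong (λ c → [ (x * 1# , c) ]) (h a))))
        (linMap-comp _≟C_ g₁ g₂ g₃ h X)

    bilin-closed : ∀ {B C D : Set} (f : B → C → List D) (PB : B → Set) (PC : C → Set) (PD : D → Set) →
      (∀ b c → PB b → PC c → All PD (f b c)) →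
      (u : LC B) → Supported PB u → (v : LC C) → Supported PC v → Supported PD (bilin f u v)
    bilin-closed f PB PC PD h [] _ v pv = []
    bilin-closed f PB PC PD h ((x , b) ∷ u) (pb ∷ pu) v pv =
      AllP.++⁺ (term v pv) (bilin-closed f PB PC PD h u pu v pv)
      where
      term : (v : LC _) → Supported PC v → Supported PD (termTimes f x b v)
      term [] _ = []
      term ((y , c′) ∷ v) (pc ∷ pv) = AllP.++⁺ (AllP.map⁺ (h b c′ pb pc)) (term v pv)


module Splitting where

  open import Data.Nat using (ℕ; zero; suc; _+_; _∸_; _≤_; _<_; _≤?_; s≤s; s≤s⁻¹)
  open import Data.Nat.Properties
  open import Data.Product using (_×_; _,_; proj₁; proj₂)
  open import Data.List using (List; []; _∷_; [_]; _++_; map; upTo; filter)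
  open import Data.List.Properties using (filter-++; filter-accept; filter-none; upTo-∷ʳ; map-upTo; map-cong; map-∘)
  open import Data.List.Membership.Propositional using (_∈_)
  open import Data.List.Membership.Propositional.Properties using (∈-upTo⁻; ∈-filter⁻)
  import Data.List.Relation.Unary.All as All
  open import Data.Sum using (inj₁; inj₂)
  open import Relation.Nullary using (yes; no; contradiction)
  open import Relation.Binary.PropositionalEquality
    using (_≡_; refl; sym; trans; cong; cong₂; subst; subst₂; module ≡-Reasoning)

  module _ {A : Set} where

    split-≤ : ∀ i (l : BT A) a r → i ≤ size l →
      split1 i (node l a r) ≡ (proj₁ (split1 i l) , node (proj₂ (split1 i l)) a r)
    split-≤ i l a r h with i ≤? size l
    ... | yes _ = refl
    ... | no ¬h = contradiction h ¬h

    split-> : ∀ i (l : BT A) a r → size l < i →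
      split1 i (node l a r) ≡ (node l a (proj₁ (split1 (i ∸ size l ∸ 1) r)) , proj₂ (split1 (i ∸ size l ∸ 1) r))
    split-> i l a r h with i ≤? size l
    ... | yes h′ = contradiction h (≤⇒≯ h′)
    ... | no _ = refl

    ∸-suc-+ : ∀ {i s} → s < i → i ∸ s ∸ 1 + suc s ≡ i
    ∸-suc-+ {i} {s} h = begin
        i ∸ s ∸ 1 + suc s   ≡⟨ cong (_+ suc s) (∸-+-assoc i s 1) ⟩
        i ∸ (s + 1) + suc s ≡⟨ cong (λ z → i ∸ z + suc s) (+-comm s 1) ⟩
        i ∸ suc s + suc s   ≡⟨ m∸n+n≡m h ⟩
        i ∎
      where open ≡-Reasoning

    size-split : ∀ i (t : BT A) → size (proj₁ (split1 i t)) + size (proj₂ (split1 i t)) ≡ size t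
    size-split i leaf = refl
    size-split i (node l a r) with i ≤? size l
    ... | yes h = begin
          size l₀ + (size l₁ + suc (size r)) ≡⟨ sym (+-assoc (size l₀) (size l₁) (suc (size r))) ⟩
          size l₀ + size l₁ + suc (size r)   ≡⟨ cong (_+ suc (size r)) (size-split i l) ⟩
          size l + suc (size r) ∎
      where open ≡-Reasoning
            l₀ = proj₁ (split1 i l)
            l₁ = proj₂ (split1 i l)
    ... | no h = begin
          size l + suc (size r₀) + size r₁ ≡⟨ +-assoc (size l) _ _ ⟩
          size l + suc (size r₀ + size r₁) ≡⟨ cong (λ z → size l + suc z) (size-split _ r) ⟩
          size l + suc (size r) ∎
      where open ≡-Reasoning
            r₀ = proj₁ (split1 (i ∸ size l ∸ 1) r)
            r₁ = proj₂ (split1 (i ∸ size l ∸ 1) r)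

    size-split₁ : ∀ i (t : BT A) → i ≤ size t → size (proj₁ (split1 i t)) ≡ i
    size-split₁ zero leaf h = refl
    size-split₁ (suc i) leaf ()
    size-split₁ i (node l a r) h with i ≤? size l
    ... | yes h′ = size-split₁ i l h′
    ... | no h′ = begin
          size l + suc (size (proj₁ (split1 k r))) ≡⟨ cong (λ z → size l + suc z) (size-split₁ k r k≤r) ⟩
          size l + suc k   ≡⟨ +-comm (size l) (suc k) ⟩
          suc k + size l   ≡⟨ sym (+-suc k (size l)) ⟩
          k + suc (size l) ≡⟨ ∸-suc-+ (≰⇒> h′) ⟩
          i ∎
      where open ≡-Reasoning
            k = i ∸ size l ∸ 1
            k≤r : k ≤ size r
            k≤r = +-cancelˡ-≤ (suc (size l)) k (size r)
                    (subst₂ _≤_ (sym (trans (+-comm (suc (size l)) k) (∸-suc-+ (≰⇒> h′)))) (+-suc (size l) (size r)) h)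

    size-split₂ : ∀ i (t : BT A) → i ≤ size t → size (proj₂ (split1 i t)) ≡ size t ∸ i
    size-split₂ i t h = begin
        size t₁                       ≡⟨ sym (m+n∸m≡n (size t₀) _) ⟩
        size t₀ + size t₁ ∸ size t₀  ≡⟨ cong₂ _∸_ (size-split i t) (size-split₁ i t h) ⟩
        size t ∸ i ∎
      where open ≡-Reasoning
            t₀ = proj₁ (split1 i t)
            t₁ = proj₂ (split1 i t)

    ∸-∸-cancel : ∀ {c a} b → c ≤ a → (b ∸ c) ∸ (a ∸ c) ≡ b ∸ a
    ∸-∸-cancel {c} {a} b h = trans (∸-+-assoc b c (a ∸ c)) (cong (b ∸_) (m+[n∸m]≡n h))

    split-coassoc : ∀ a b (t : BT A) → a ≤ b →
      (split1 a (proj₁ (split1 b t)) ≡ (proj₁ (split1 a t) , proj₁ (split1 (b ∸ a) (proj₂ (split1 a t)))))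
      × (proj₂ (split1 b t) ≡ proj₂ (split1 (b ∸ a) (proj₂ (split1 a t))))
    split-coassoc a b leaf h = refl , refl
    split-coassoc a b (node l x r) h with ≤-<-connex b (size l) | ≤-<-connex a (size l)
    ... | inj₁ hb | inj₁ ha
      rewrite split-≤ b l x r hb | split-≤ a l x r ha
            | split-≤ (b ∸ a) (proj₂ (split1 a l)) x r (subst (b ∸ a ≤_) (sym (size-split₂ a l ha)) (∸-monoˡ-≤ a hb))
            = proj₁ (split-coassoc a b l h) , cong (λ z → node z x r) (proj₂ (split-coassoc a b l h))
    ... | inj₁ hb | inj₂ ha = contradiction (≤-trans h hb) (<⇒≱ ha)
    ... | inj₂ hb | inj₁ ha
      rewrite split-> b l x r hb | split-≤ a l x r ha
            | split-≤ a l x (proj₁ (split1 (b ∸ size l ∸ 1) r)) ha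
            | split-> (b ∸ a) (proj₂ (split1 a l)) x r (subst (_< b ∸ a) (sym (size-split₂ a l ha)) (∸-monoˡ-< hb ha))
            | cong (_∸ 1) (trans (cong (b ∸ a ∸_) (size-split₂ a l ha)) (∸-∸-cancel b ha)) = refl , refl
    ... | inj₂ hb | inj₂ ha
      rewrite split-> b l x r hb | split-> a l x r ha
            | split-> a l x (proj₁ (split1 (b ∸ size l ∸ 1) r)) ha
            = cong (λ z → (node l x (proj₁ z)) , proj₂ z)
                   (subst (λ w → split1 a′ (proj₁ (split1 b′ r)) ≡ (proj₁ (split1 a′ r) , proj₁ (split1 w (proj₂ (split1 a′ r)))))
                          b′∸a′ (proj₁ IH))
            , subst (λ w → proj₂ (split1 b′ r) ≡ proj₂ (split1 w (proj₂ (split1 a′ r)))) b′∸a′ (proj₂ IH)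
      where a′ = a ∸ size l ∸ 1
            b′ = b ∸ size l ∸ 1
            IH = split-coassoc a′ b′ r (∸-monoˡ-≤ 1 (∸-monoˡ-≤ (size l) h))
            b′∸a′ : b′ ∸ a′ ≡ b ∸ a
            b′∸a′ = trans (cong₂ _∸_ (∸-+-assoc b (size l) 1) (∸-+-assoc a (size l) 1))
                          (∸-∸-cancel b (subst (_≤ a) (+-comm 1 (size l)) ha))

  range : ℕ → ℕ → List ℕ
  range lo N = filter (lo ≤?_) (upTo (suc N))

  filter-upTo-below : ∀ m lo → m ≤ lo → filter (lo ≤?_) (upTo m) ≡ []
  filter-upTo-below m lo h = filter-none (lo ≤?_) (All.tabulate λ x∈ lo≤x → <⇒≱ (≤-trans (∈-upTo⁻ x∈) h) lo≤x)

  range-empty : ∀ lo N → N < lo → range lo N ≡ []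
  range-empty lo N h = filter-upTo-below (suc N) lo h

  range-snoc : ∀ lo N → lo ≤ suc N → range lo (suc N) ≡ range lo N ++ [ suc N ]
  range-snoc lo N h = begin
      filter (lo ≤?_) (upTo (suc (suc N)))          ≡⟨ cong (filter (lo ≤?_)) (sym (upTo-∷ʳ (suc N))) ⟩
      filter (lo ≤?_) (upTo (suc N) ++ [ suc N ])   ≡⟨ filter-++ (lo ≤?_) (upTo (suc N)) [ suc N ] ⟩
      range lo N ++ filter (lo ≤?_) [ suc N ]       ≡⟨ cong (range lo N ++_) (filter-accept (lo ≤?_) h) ⟩
      range lo N ++ [ suc N ] ∎
    where open ≡-Reasoning

  range-cons : ∀ lo N → lo ≤ N → range lo N ≡ lo ∷ range (suc lo) N
  range-cons lo N h with m≤n⇒m<n∨m≡n h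
  ... | inj₂ refl = begin
      filter (lo ≤?_) (upTo (suc lo))                     ≡⟨ cong (filter (lo ≤?_)) (sym (upTo-∷ʳ lo)) ⟩
      filter (lo ≤?_) (upTo lo ++ [ lo ])                 ≡⟨ filter-++ (lo ≤?_) (upTo lo) [ lo ] ⟩
      filter (lo ≤?_) (upTo lo) ++ filter (lo ≤?_) [ lo ] ≡⟨ cong₂ _++_ (filter-upTo-below lo lo ≤-refl) (filter-accept (lo ≤?_) ≤-refl) ⟩
      [ lo ]                                              ≡⟨ cong (lo ∷_) (sym (range-empty (suc lo) lo ≤-refl)) ⟩
      lo ∷ range (suc lo) lo ∎
    where open ≡-Reasoning
  range-cons lo (suc N) h | inj₁ (s≤s lo≤N) = begin
      range lo (suc N)                      ≡⟨ range-snoc lo N h ⟩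
      range lo N ++ [ suc N ]               ≡⟨ cong (_++ [ suc N ]) (range-cons lo N lo≤N) ⟩
      lo ∷ (range (suc lo) N ++ [ suc N ])  ≡⟨ cong (lo ∷_) (sym (range-snoc (suc lo) N (s≤s lo≤N))) ⟩
      lo ∷ range (suc lo) (suc N) ∎
    where open ≡-Reasoning

  range-mem : ∀ {lo N k} → k ∈ range lo N → lo ≤ k × k ≤ N
  range-mem {lo} {N} k∈ with ∈-filter⁻ (lo ≤?_) {xs = upTo (suc N)} k∈
  ... | k∈′ , lo≤k = lo≤k , s≤s⁻¹ (∈-upTo⁻ k∈′)

  range-shift : ∀ o n → range o (o + n) ≡ map (o +_) (upTo (suc n))
  range-shift o zero = begin
      range o (o + 0)     ≡⟨ cong (range o) (+-identityʳ o) ⟩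
      range o o           ≡⟨ range-cons o o ≤-refl ⟩
      o ∷ range (suc o) o ≡⟨ cong (o ∷_) (range-empty (suc o) o ≤-refl) ⟩
      [ o ]               ≡⟨ cong [_] (sym (+-identityʳ o)) ⟩
      [ o + 0 ] ∎
    where open ≡-Reasoning
  range-shift o (suc n) = begin
      range o (o + suc n)                              ≡⟨ range-cons o (o + suc n) (m≤m+n o (suc n)) ⟩
      o ∷ range (suc o) (o + suc n)                    ≡⟨ cong (λ z → o ∷ range (suc o) z) (+-suc o n) ⟩
      o ∷ range (suc o) (suc o + n)                    ≡⟨ cong (o ∷_) (range-shift (suc o) n) ⟩
      o ∷ map (suc o +_) (upTo (suc n))                ≡⟨ cong₂ _∷_ (sym (+-identityʳ o)) (map-cong (λ x → sym (+-suc o x)) (upTo (suc n))) ⟩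
      o + 0 ∷ map (λ x → o + suc x) (upTo (suc n))     ≡⟨ cong (o + 0 ∷_) (map-∘ (upTo (suc n))) ⟩
      o + 0 ∷ map (o +_) (map suc (upTo (suc n)))      ≡⟨ cong (λ z → o + 0 ∷ map (o +_) z) (map-upTo suc (suc n)) ⟩
      map (o +_) (upTo (suc (suc n))) ∎
    where open ≡-Reasoning


-- All splittings at once.  graftings o t s lists the trees (t₀,…,t_p)/s over
-- all p-splittings of t (indices shifted by o).  The main result,
-- graftings-node, says how this list decomposes when s = node s₁ M s₂: choose
-- the cut j separating the leaves of s₁ from those of s₂, then graft the left
-- part of t onto s₁ and the right part onto s₂.  The combinatorial input is the
-- corresponding decomposition of nondecreasing index sequences (ndSeqs-split).
module Grafting where

  open PermLemmas
  open Splitting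
  open import Data.Nat using (ℕ; zero; suc; _+_; _∸_; _≤_; s≤s⁻¹)
  open import Data.Nat.Properties
  open import Data.Product using (_×_; _,_; proj₁; proj₂)
  open import Data.Sum using (inj₁; inj₂)
  open import Data.Unit using (⊤; tt)
  open import Data.List using (List; []; _∷_; [_]; _++_; map; concatMap; length; upTo)
  open import Data.List.Properties using (++-identityʳ; ++-assoc; map-∘; concatMap-cong; map-cong)
  open import Data.List.Membership.Propositional using (_∈_; find)
  open import Data.List.Membership.Propositional.Properties using (∈-map⁻; ∈-upTo⁻; ∈-concatMap⁻)
  open import Data.List.Relation.Unary.Any using (here)
  open import Data.List.Relation.Binary.Permutation.Propositional
    using (_↭_; ↭-refl; ↭-sym; ↭-trans; module PermutationReasoning)
  import Data.List.Relation.Binary.Permutation.Propositional.Properties as PermP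
  open import Relation.Binary.PropositionalEquality
    using (_≡_; refl; sym; trans; cong; cong₂; subst; module ≡-Reasoning)

  nodes : ∀ {A : Set} → A → List (BT A) → List (BT A) → List (BT A)
  nodes M X Y = concatMap (λ x → map (λ y → node x M y) Y) X

  nodes-↭ : ∀ {A : Set} (M : A) {X X′ Y Y′ : List (BT A)} → X ↭ X′ → Y ↭ Y′ → nodes M X Y ↭ nodes M X′ Y′
  nodes-↭ M {X′ = X′} {Y} X↭X′ Y↭Y′ =
    ↭-trans (concatMap-resp-↭ (λ x → map (λ y → node x M y) Y) X↭X′) (concatMap-↭ X′ (λ x → PermP.map⁺ (λ y → node x M y) Y↭Y′))

  module _ {X : Set} where

    -- a double sum over lo ≤ i ≤ k ≤ N, summed row by row / column by column
    byRows byColumns : (ℕ → ℕ → List X) → ℕ → ℕ → List X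
    byRows f lo N = concatMap (λ i → concatMap (λ k → f i k) (range i N)) (range lo N)
    byColumns f lo N = concatMap (λ k → concatMap (λ i → f i k) (range lo k)) (range lo N)

    range-single : ∀ lo → range lo lo ≡ [ lo ]
    range-single lo = trans (range-cons lo lo ≤-refl) (cong (lo ∷_) (range-empty (suc lo) lo ≤-refl))

    triangle-swap′ : ∀ d lo N → lo + d ≡ N → (f : ℕ → ℕ → List X) → byRows f lo N ↭ byColumns f lo N
    triangle-swap′ zero lo N refl f rewrite +-identityʳ lo = ≡⇒↭ (begin
        byRows f lo lo                                 ≡⟨ cong (concatMap (λ i → concatMap (λ k → f i k) (range i lo))) (range-single lo) ⟩
        concatMap (λ k → f lo k) (range lo lo) ++ []   ≡⟨ cong (λ z → concatMap (λ k → f lo k) z ++ []) (range-single lo) ⟩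
        (f lo lo ++ []) ++ []                          ≡⟨ cong (λ z → concatMap (λ i → f i lo) z ++ []) (sym (range-single lo)) ⟩
        concatMap (λ i → f i lo) (range lo lo) ++ []   ≡⟨ cong (concatMap (λ k → concatMap (λ i → f i k) (range lo k))) (sym (range-single lo)) ⟩
        byColumns f lo lo ∎)
      where open ≡-Reasoning
    triangle-swap′ (suc d) lo N eq f = begin
        byRows f lo N
          ≡⟨ cong (concatMap (λ i → concatMap (λ k → f i k) (range i N))) lo∷ ⟩
        row lo ++ byRows f (suc lo) N
          ↭⟨ PermP.++⁺ˡ (row lo) (triangle-swap′ d (suc lo) N (trans (sym (+-suc lo d)) eq) f) ⟩
        row lo ++ byColumns f (suc lo) N
          ≡⟨ cong (λ z → concatMap (λ k → f lo k) z ++ byColumns f (suc lo) N) lo∷ ⟩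
        (f lo lo ++ concatMap (λ k → f lo k) (range (suc lo) N)) ++ byColumns f (suc lo) N
          ≡⟨ ++-assoc (f lo lo) _ _ ⟩
        f lo lo ++ (concatMap (λ k → f lo k) (range (suc lo) N) ++ byColumns f (suc lo) N)
          ↭⟨ PermP.++⁺ˡ (f lo lo) (↭-sym (concatMap-++-split (λ k → f lo k) (λ k → column (suc lo) k) (range (suc lo) N))) ⟩
        f lo lo ++ concatMap (λ k → f lo k ++ column (suc lo) k) (range (suc lo) N)
          ↭⟨ PermP.++⁺ (≡⇒↭ (sym (++-identityʳ (f lo lo)))) (concatMap-↭-local (range (suc lo) N) (λ k∈ → ≡⇒↭ (extend-column k∈))) ⟩
        (f lo lo ++ []) ++ concatMap (λ k → column lo k) (range (suc lo) N)
          ≡⟨ cong (λ z → concatMap (λ i → f i lo) z ++ concatMap (λ k → column lo k) (range (suc lo) N)) (sym (range-single lo)) ⟩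
        column lo lo ++ concatMap (λ k → column lo k) (range (suc lo) N)
          ≡⟨ cong (concatMap (λ k → column lo k)) (sym lo∷) ⟩
        byColumns f lo N ∎
      where
      open PermutationReasoning
      row = λ i → concatMap (λ k → f i k) (range i N)
      column = λ lo′ k → concatMap (λ i → f i k) (range lo′ k)
      lo∷ : range lo N ≡ lo ∷ range (suc lo) N
      lo∷ = range-cons lo N (subst (lo ≤_) eq (m≤m+n lo (suc d)))
      extend-column : ∀ {k} → k ∈ range (suc lo) N → f lo k ++ column (suc lo) k ≡ column lo k
      extend-column k∈ = sym (cong (concatMap (λ i → f i _)) (range-cons lo _ (≤-trans (n≤1+n lo) (proj₁ (range-mem {suc lo} {N} k∈)))))

    triangle-swap : ∀ lo N → (f : ℕ → ℕ → List X) → byRows f lo N ↭ byColumns f lo N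
    triangle-swap lo N f with ≤-<-connex lo N
    ... | inj₁ h = triangle-swap′ (N ∸ lo) lo N (m+[n∸m]≡n h) f
    ... | inj₂ h rewrite range-empty lo N h = ↭-refl

  ndSeqs-split : ∀ p₁ p₂ lo N → ndSeqs (p₁ + suc p₂) lo N ↭
    concatMap (λ k → concatMap (λ is₁ → map (λ is₂ → is₁ ++ k ∷ is₂) (ndSeqs p₂ k N)) (ndSeqs p₁ lo k)) (range lo N)
  ndSeqs-split zero p₂ lo N = ≡⇒↭ (concatMap-cong (λ k → sym (++-identityʳ _)) (range lo N))
  ndSeqs-split (suc p) p₂ lo N = begin
      concatMap (λ i → map (i ∷_) (ndSeqs (p + suc p₂) i N)) (range lo N)
        ↭⟨ concatMap-↭ (range lo N) (λ i → PermP.map⁺ (i ∷_) (ndSeqs-split p p₂ i N)) ⟩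
      concatMap (λ i → map (i ∷_) (concatMap (λ k → glue k (ndSeqs p i k)) (range i N))) (range lo N)
        ≡⟨ concatMap-cong (λ i → trans (map-concatMap (i ∷_) _ (range i N))
             (concatMap-cong (λ k → trans (map-concatMap (i ∷_) _ (ndSeqs p i k))
               (concatMap-cong (λ is₁ → sym (map-∘ (ndSeqs p₂ k N))) (ndSeqs p i k))) (range i N))) (range lo N) ⟩
      byRows cell lo N
        ↭⟨ triangle-swap lo N cell ⟩
      byColumns cell lo N
        ≡⟨ concatMap-cong (λ k → trans (concatMap-cong (λ i → sym (concatMap-map (glue₁ k) (i ∷_) (ndSeqs p i k))) (range lo k))
                                       (sym (concatMap-concatMap (glue₁ k) (λ i → map (i ∷_) (ndSeqs p i k)) (range lo k)))) (range lo N) ⟩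
      concatMap (λ k → glue k (ndSeqs (suc p) lo k)) (range lo N) ∎
    where
    open PermutationReasoning
    glue₁ : ℕ → List ℕ → List (List ℕ)
    glue₁ k is₁ = map (λ is₂ → is₁ ++ k ∷ is₂) (ndSeqs p₂ k N)
    glue : ℕ → List (List ℕ) → List (List ℕ)
    glue k iss = concatMap (glue₁ k) iss
    cell : ℕ → ℕ → List (List ℕ)
    cell i k = concatMap (λ is₁ → glue₁ k (i ∷ is₁)) (ndSeqs p i k)

  Bounded : ℕ → ℕ → List ℕ → Set
  Bounded lo hi [] = ⊤
  Bounded lo hi (i ∷ is) = lo ≤ i × i ≤ hi × Bounded i hi is

  ndSeqs-mem : ∀ p lo N {is} → is ∈ ndSeqs p lo N → Bounded lo N is × length is ≡ p
  ndSeqs-mem zero lo N (here refl) = tt , refl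
  ndSeqs-mem (suc p) lo N {is} is∈ with find (∈-concatMap⁻ (λ i → map (i ∷_) (ndSeqs p i N)) {xs = range lo N} is∈)
  ... | i , i∈ , is∈′ with ∈-map⁻ (i ∷_) is∈′
  ... | is′ , is′∈ , refl with range-mem i∈ | ndSeqs-mem p i N is′∈
  ...   | lo≤i , i≤N | bounded , len = (lo≤i , i≤N , bounded) , cong suc len

  module _ {A : Set} where

    -- splitting along is₁ ++ k ∷ is₂ = cutting at k, then splitting both halves
    -- (a consequence of split-coassoc)
    pSplit-++ : ∀ o k is₁ is₂ (t : BT A) → Bounded o k is₁ →
      pSplitFrom o (is₁ ++ k ∷ is₂) t ≡ pSplitFrom o is₁ (proj₁ (split1 (k ∸ o) t)) ++ pSplitFrom k is₂ (proj₂ (split1 (k ∸ o) t))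
    pSplit-++ o k [] is₂ t _ = refl
    pSplit-++ o k (i ∷ is₁) is₂ t (o≤i , i≤k , bounded) = begin
        proj₁ (split1 (i ∸ o) t) ∷ pSplitFrom i (is₁ ++ k ∷ is₂) t′
          ≡⟨ cong (proj₁ (split1 (i ∸ o) t) ∷_) (pSplit-++ i k is₁ is₂ _ bounded) ⟩
        proj₁ (split1 (i ∸ o) t) ∷ (pSplitFrom i is₁ (proj₁ (split1 (k ∸ i) t′)) ++ pSplitFrom k is₂ (proj₂ (split1 (k ∸ i) t′)))
          ≡⟨ cong₂ (λ u v → proj₁ u ∷ (pSplitFrom i is₁ (proj₂ u) ++ pSplitFrom k is₂ v)) (sym left) (sym right) ⟩
        proj₁ (split1 (i ∸ o) L) ∷ (pSplitFrom i is₁ (proj₂ (split1 (i ∸ o) L)) ++ pSplitFrom k is₂ (proj₂ (split1 (k ∸ o) t))) ∎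
      where
      open ≡-Reasoning
      t′ = proj₂ (split1 (i ∸ o) t)
      L = proj₁ (split1 (k ∸ o) t)
      coassoc = split-coassoc (i ∸ o) (k ∸ o) t (∸-monoˡ-≤ o i≤k)
      k-i : k ∸ o ∸ (i ∸ o) ≡ k ∸ i
      k-i = ∸-∸-cancel {A = A} k o≤i
      left : split1 (i ∸ o) L ≡ (proj₁ (split1 (i ∸ o) t) , proj₁ (split1 (k ∸ i) t′))
      left = trans (proj₁ coassoc) (cong (λ z → (proj₁ (split1 (i ∸ o) t) , proj₁ (split1 z t′))) k-i)
      right : proj₂ (split1 (k ∸ o) t) ≡ proj₂ (split1 (k ∸ i) t′)
      right = trans (proj₂ coassoc) (cong (λ z → proj₂ (split1 z t′)) k-i)

    length-pSplit : ∀ o is (t : BT A) → length (pSplitFrom o is t) ≡ suc (length is)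
    length-pSplit o [] t = refl
    length-pSplit o (i ∷ is) t = cong suc (length-pSplit i is _)

    graftAux-++ : ∀ (s : BT A) ts ts′ m → length ts ≡ suc (size s) + m →
      (graftAux s (ts ++ ts′) ≡ (proj₁ (graftAux s ts) , proj₂ (graftAux s ts) ++ ts′))
      × length (proj₂ (graftAux s ts)) ≡ m
    graftAux-++ leaf (t ∷ ts) ts′ m eq = refl , suc-injective eq
    graftAux-++ (node l a r) ts ts′ m eq = graft-eq , proj₂ IHr
      where
      eq′ : length ts ≡ suc (size l) + (suc (size r) + m)
      eq′ = trans eq (cong suc (+-assoc (size l) (suc (size r)) m))
      IHl = graftAux-++ l ts ts′ (suc (size r) + m) eq′
      IHr = graftAux-++ r (proj₂ (graftAux l ts)) ts′ m (proj₂ IHl)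
      graft-eq : graftAux (node l a r) (ts ++ ts′) ≡ (proj₁ (graftAux (node l a r) ts) , proj₂ (graftAux (node l a r) ts) ++ ts′)
      graft-eq rewrite proj₁ IHl | proj₁ IHr = refl

    graft-node : ∀ (s₁ : BT A) M s₂ ts₁ ts₂ → length ts₁ ≡ suc (size s₁) →
      graft (ts₁ ++ ts₂) (node s₁ M s₂) ≡ node (graft ts₁ s₁) M (graft ts₂ s₂)
    graft-node s₁ M s₂ ts₁ ts₂ eq with graftAux-++ s₁ ts₁ ts₂ 0 (trans eq (cong suc (sym (+-identityʳ (size s₁)))))
    ... | e , l0 rewrite e with proj₂ (graftAux s₁ ts₁) | l0
    ... | [] | _ = refl

    graftings : ℕ → BT A → BT A → List (BT A)
    graftings o t s = map (λ is → graft (pSplitFrom o is t) s) (ndSeqs (size s) o (o + size t))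

    graftingsThrough : ℕ → BT A → BT A → A → BT A → ℕ → List (BT A)
    graftingsThrough o t s₁ M s₂ k =
      concatMap (λ is₁ → map (λ is₂ → node (graft (pSplitFrom o is₁ (proj₁ (split1 (k ∸ o) t))) s₁) M
                                            (graft (pSplitFrom k is₂ (proj₂ (split1 (k ∸ o) t))) s₂))
                             (ndSeqs (size s₂) k (o + size t)))
                (ndSeqs (size s₁) o k)

    graftingsThrough-cut : ∀ o (t : BT A) s₁ M s₂ j → j ≤ size t →
      graftingsThrough o t s₁ M s₂ (o + j) ≡
        nodes M (graftings o (proj₁ (split1 j t)) s₁) (graftings (o + j) (proj₂ (split1 j t)) s₂)
    graftingsThrough-cut o t s₁ M s₂ j j≤n = begin
        glued (o + j ∸ o) (o + j) N             ≡⟨ cong (λ z → glued z (o + j) N) (m+n∸m≡n o j) ⟩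
        glued j (o + j) N                       ≡⟨ cong₂ (glued j) (cong (o +_) (sym (size-split₁ j t j≤n))) (sym right-end) ⟩
        glued j (o + size (L j)) (o + j + size (R j))
          ≡⟨ concatMap-cong (λ is₁ → map-∘ (ndSeqs p₂ (o + j) (o + j + size (R j)))) (ndSeqs p₁ o (o + size (L j))) ⟩
        concatMap (λ is₁ → map (λ y → node (G₁ is₁) M y) (graftings (o + j) (R j) s₂)) (ndSeqs p₁ o (o + size (L j)))
          ≡⟨ sym (concatMap-map (λ x → map (λ y → node x M y) (graftings (o + j) (R j) s₂)) G₁ (ndSeqs p₁ o (o + size (L j)))) ⟩
        nodes M (graftings o (L j) s₁) (graftings (o + j) (R j) s₂) ∎
      where
      open ≡-Reasoning
      p₁ = size s₁
      p₂ = size s₂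
      n = size t
      N = o + n
      L = λ j → proj₁ (split1 j t)
      R = λ j → proj₂ (split1 j t)
      G₁ = λ is₁ → graft (pSplitFrom o is₁ (L j)) s₁
      glued : ℕ → ℕ → ℕ → List (BT A)
      glued z a b = concatMap (λ is₁ → map (λ is₂ → node (graft (pSplitFrom o is₁ (L z)) s₁) M (graft (pSplitFrom (o + j) is₂ (R z)) s₂))
                                           (ndSeqs p₂ (o + j) b))
                              (ndSeqs p₁ o a)
      right-end : o + j + size (R j) ≡ N
      right-end = trans (cong (o + j +_) (size-split₂ j t j≤n)) (trans (+-assoc o j (n ∸ j)) (cong (o +_) (m+[n∸m]≡n j≤n)))

    graftings-node : ∀ o (t : BT A) s₁ M s₂ → graftings o t (node s₁ M s₂) ↭
      concatMap (λ j → nodes M (graftings o (proj₁ (split1 j t)) s₁) (graftings (o + j) (proj₂ (split1 j t)) s₂)) (upTo (suc (size t)))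
    graftings-node o t s₁ M s₂ = begin
        map G (ndSeqs (p₁ + suc p₂) o N)
          ↭⟨ PermP.map⁺ G (ndSeqs-split p₁ p₂ o N) ⟩
        map G (concatMap (λ k → concatMap (λ is₁ → map (λ is₂ → is₁ ++ k ∷ is₂) (ndSeqs p₂ k N)) (ndSeqs p₁ o k)) (range o N))
          ≡⟨ trans (map-concatMap G _ (range o N)) (concatMap-cong (λ k → trans (map-concatMap G _ (ndSeqs p₁ o k))
               (concatMap-cong (λ is₁ → sym (map-∘ (ndSeqs p₂ k N))) (ndSeqs p₁ o k))) (range o N)) ⟩
        concatMap (λ k → concatMap (λ is₁ → map (λ is₂ → G (is₁ ++ k ∷ is₂)) (ndSeqs p₂ k N)) (ndSeqs p₁ o k)) (range o N)
          ≡⟨ concatMap-cong (λ k → concatMap-cong-local (ndSeqs p₁ o k)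
               (λ {is₁} m → map-cong (λ is₂ → split-graft k is₁ is₂ (ndSeqs-mem p₁ o k m)) (ndSeqs p₂ k N))) (range o N) ⟩
        concatMap (graftingsThrough o t s₁ M s₂) (range o N)
          ≡⟨ cong (concatMap (graftingsThrough o t s₁ M s₂)) (range-shift o n) ⟩
        concatMap (graftingsThrough o t s₁ M s₂) (map (o +_) (upTo (suc n)))
          ≡⟨ concatMap-map (graftingsThrough o t s₁ M s₂) (o +_) (upTo (suc n)) ⟩
        concatMap (λ j → graftingsThrough o t s₁ M s₂ (o + j)) (upTo (suc n))
          ≡⟨ concatMap-cong-local (upTo (suc n)) (λ {j} m → graftingsThrough-cut o t s₁ M s₂ j (s≤s⁻¹ (∈-upTo⁻ m))) ⟩
        concatMap (λ j → nodes M (graftings o (proj₁ (split1 j t)) s₁) (graftings (o + j) (proj₂ (split1 j t)) s₂)) (upTo (suc n)) ∎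
      where
      open PermutationReasoning
      p₁ = size s₁
      p₂ = size s₂
      n = size t
      N = o + n
      G = λ is → graft (pSplitFrom o is t) (node s₁ M s₂)
      split-graft : ∀ k is₁ is₂ → Bounded o k is₁ × length is₁ ≡ p₁ →
        G (is₁ ++ k ∷ is₂) ≡ node (graft (pSplitFrom o is₁ (proj₁ (split1 (k ∸ o) t))) s₁) M (graft (pSplitFrom k is₂ (proj₂ (split1 (k ∸ o) t))) s₂)
      split-graft k is₁ is₂ (bounded , len) = trans (cong (λ z → graft z (node s₁ M s₂)) (pSplit-++ o k is₁ is₂ t bounded))
        (graft-node s₁ M s₂ _ _ (trans (length-pSplit o is₁ _) (cong suc len)))


module DecTree where

  open import Data.Nat as ℕ using (ℕ; zero; suc; _+_; _∸_; _≤_; _<_; z≤n; s≤s; _⊔_)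
  open import Data.Nat.Properties
  open import Data.Product using (_×_; _,_; proj₁; proj₂)
  open import Data.Sum using (inj₁; inj₂)
  open import Data.Unit using (⊤; tt)
  open import Data.List using (List; []; _∷_; _++_; map; length; take; drop)
  open import Data.List.Properties using (length-++; take-[]; drop-[]; map-++)
  open import Data.List.Relation.Unary.All using (All; []; _∷_)
  import Data.List.Relation.Unary.All as All
  import Data.List.Relation.Unary.All.Properties as AllP
  open import Relation.Nullary using (yes; no; contradiction)
  open import Relation.Binary.PropositionalEquality
    using (_≡_; refl; sym; trans; cong; cong₂; subst; module ≡-Reasoning)
  open Splitting using (split-≤; split->)

  AllBT : {A : Set} → (A → Set) → BT A → Set
  AllBT P leaf = ⊤
  AllBT P (node l a r) = AllBT P l × P a × AllBT P r

  maxL-at-max : ∀ u₁ M u₂ → All (_< M) u₁ → All (_≤ M) u₂ → maxL (u₁ ++ M ∷ u₂) ≡ M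
  maxL-at-max [] M u₂ _ h = m≥n⇒m⊔n≡m (maxL-≤ u₂ h)
    where
    maxL-≤ : ∀ u → All (_≤ M) u → maxL u ≤ M
    maxL-≤ [] _ = z≤n
    maxL-≤ (x ∷ u) (p ∷ ps) = ⊔-lub p (maxL-≤ u ps)
  maxL-at-max (x ∷ u₁) M u₂ (p ∷ ps) h = trans (cong (x ⊔_) (maxL-at-max u₁ M u₂ ps h)) (m≤n⇒m⊔n≡n (<⇒≤ p))

  splitAtVal-at-max : ∀ u₁ M u₂ → All (_< M) u₁ → splitAtVal M (u₁ ++ M ∷ u₂) ≡ (u₁ , u₂)
  splitAtVal-at-max [] M u₂ _ with M ℕ.≟ M
  ... | yes _ = refl
  ... | no ne = contradiction refl ne
  splitAtVal-at-max (x ∷ u₁) M u₂ (p ∷ ps) with x ℕ.≟ M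
  ... | yes refl = contradiction p (n≮n x)
  ... | no _ rewrite splitAtVal-at-max u₁ M u₂ ps = refl

  decTreeF-at-max : ∀ k u₁ M u₂ → All (_< M) u₁ → All (_≤ M) u₂ →
    decTreeF (suc k) (u₁ ++ M ∷ u₂) ≡ node (decTreeF k u₁) M (decTreeF k u₂)
  decTreeF-at-max k [] M u₂ lt le
    rewrite maxL-at-max [] M u₂ lt le | splitAtVal-at-max [] M u₂ lt = refl
  decTreeF-at-max k (x ∷ u₁) M u₂ lt le
    rewrite maxL-at-max (x ∷ u₁) M u₂ lt le | splitAtVal-at-max (x ∷ u₁) M u₂ lt = refl

  record MaxSplit (w : List ℕ) : Set where
    constructor maxSplitAt
    field
      u₁ : List ℕ
      M : ℕ
      u₂ : List ℕ
      eq : w ≡ u₁ ++ M ∷ u₂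
      lt : All (_< M) u₁
      le : All (_≤ M) u₂

  maxSplit : ∀ x w → MaxSplit (x ∷ w)
  maxSplit x [] = maxSplitAt [] x [] refl [] []
  maxSplit x (y ∷ w) with maxSplit y w
  ... | maxSplitAt u₁ M u₂ eq lt le rewrite eq with x <? M
  ...   | yes x<M = maxSplitAt (x ∷ u₁) M u₂ refl (x<M ∷ lt) le
  ...   | no x≮M = maxSplitAt [] x (u₁ ++ M ∷ u₂) refl []
                     (AllP.++⁺ (All.map (λ p → ≤-trans (<⇒≤ p) (≮⇒≥ x≮M)) lt) (≮⇒≥ x≮M ∷ All.map (λ p → ≤-trans p (≮⇒≥ x≮M)) le))

  parts-shorter : ∀ {w} u₁ (M : ℕ) u₂ → w ≡ u₁ ++ M ∷ u₂ → ∀ {k} → length w ≤ suc k →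
    length u₁ ≤ k × length u₂ ≤ k
  parts-shorter u₁ M u₂ refl h with subst (_≤ _) (trans (length-++ u₁) (+-suc (length u₁) (length u₂))) h
  ... | s≤s len = ≤-trans (m≤m+n (length u₁) (length u₂)) len , ≤-trans (m≤n+m (length u₂) (length u₁)) len

  decTreeF-fuel : ∀ k k′ w → length w ≤ k → length w ≤ k′ → decTreeF k w ≡ decTreeF k′ w
  decTreeF-fuel zero zero [] _ _ = refl
  decTreeF-fuel zero (suc k′) [] _ _ = refl
  decTreeF-fuel (suc k) zero [] _ _ = refl
  decTreeF-fuel (suc k) (suc k′) [] _ _ = refl
  decTreeF-fuel (suc k) (suc k′) (x ∷ w) h h′ with maxSplit x w
  ... | maxSplitAt u₁ M u₂ eq lt le = begin
      decTreeF (suc k) (x ∷ w)                  ≡⟨ cong (decTreeF (suc k)) eq ⟩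
      decTreeF (suc k) (u₁ ++ M ∷ u₂)           ≡⟨ decTreeF-at-max k u₁ M u₂ lt le ⟩
      node (decTreeF k u₁) M (decTreeF k u₂)    ≡⟨ cong₂ (λ a b → node a M b) (decTreeF-fuel k k′ u₁ (proj₁ short) (proj₁ short′))
                                                                             (decTreeF-fuel k k′ u₂ (proj₂ short) (proj₂ short′)) ⟩
      node (decTreeF k′ u₁) M (decTreeF k′ u₂)  ≡⟨ sym (decTreeF-at-max k′ u₁ M u₂ lt le) ⟩
      decTreeF (suc k′) (u₁ ++ M ∷ u₂)          ≡⟨ cong (decTreeF (suc k′)) (sym eq) ⟩
      decTreeF (suc k′) (x ∷ w) ∎
    where
    open ≡-Reasoning
    short = parts-shorter u₁ M u₂ eq h
    short′ = parts-shorter u₁ M u₂ eq h′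

  decTree-node : ∀ u₁ M u₂ → All (_< M) u₁ → All (_≤ M) u₂ → decTree (u₁ ++ M ∷ u₂) ≡ node (decTree u₁) M (decTree u₂)
  decTree-node u₁ M u₂ lt le = begin
      decTreeF (length (u₁ ++ M ∷ u₂)) (u₁ ++ M ∷ u₂)          ≡⟨ cong (λ z → decTreeF z (u₁ ++ M ∷ u₂)) len ⟩
      decTreeF (suc (length u₁ + length u₂)) (u₁ ++ M ∷ u₂)    ≡⟨ decTreeF-at-max _ u₁ M u₂ lt le ⟩
      node (decTreeF (length u₁ + length u₂) u₁) M (decTreeF (length u₁ + length u₂) u₂)
        ≡⟨ cong₂ (λ a b → node a M b) (decTreeF-fuel _ _ u₁ (m≤m+n (length u₁) (length u₂)) ≤-refl)
                                      (decTreeF-fuel _ _ u₂ (m≤n+m (length u₂) (length u₁)) ≤-refl) ⟩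
      node (decTree u₁) M (decTree u₂) ∎
    where
    open ≡-Reasoning
    len : length (u₁ ++ M ∷ u₂) ≡ suc (length u₁ + length u₂)
    len = trans (length-++ u₁) (+-suc (length u₁) (length u₂))

  -- the recursion pattern of decTree, as an inductive view
  data DecView (w : List ℕ) : Set where
    dv-empty : w ≡ [] → DecView w
    dv-max : ∀ u₁ M u₂ → w ≡ u₁ ++ M ∷ u₂ → All (_< M) u₁ → All (_≤ M) u₂ →
             DecView u₁ → DecView u₂ → DecView w

  decView′ : ∀ n w → length w ≤ n → DecView w
  decView′ n [] _ = dv-empty refl
  decView′ (suc n) (x ∷ w) h with maxSplit x w
  ... | maxSplitAt u₁ M u₂ eq lt le =
    dv-max u₁ M u₂ eq lt le (decView′ n u₁ (proj₁ short)) (decView′ n u₂ (proj₂ short))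
    where short = parts-shorter u₁ M u₂ eq h

  decView : ∀ w → DecView w
  decView w = decView′ (length w) w ≤-refl

  decTree-node′ : ∀ {w} u₁ M u₂ → w ≡ u₁ ++ M ∷ u₂ → All (_< M) u₁ → All (_≤ M) u₂ →
    decTree w ≡ node (decTree u₁) M (decTree u₂)
  decTree-node′ u₁ M u₂ refl lt le = decTree-node u₁ M u₂ lt le

  size-decTree : ∀ w → size (decTree w) ≡ length w
  size-decTree w = go w (decView w)
    where
    go : ∀ w → DecView w → size (decTree w) ≡ length w
    go w (dv-empty refl) = refl
    go w (dv-max u₁ M u₂ eq lt le v₁ v₂) rewrite decTree-node′ u₁ M u₂ eq lt le | eq =
      trans (cong₂ (λ a b → a + suc b) (go u₁ v₁) (go u₂ v₂)) (sym (length-++ u₁))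

  All-decTree : ∀ {P : ℕ → Set} w → All P w → AllBT P (decTree w)
  All-decTree {P} w = go w (decView w)
    where
    go : ∀ w → DecView w → All P w → AllBT P (decTree w)
    go w (dv-empty refl) _ = tt
    go w (dv-max u₁ M u₂ eq lt le v₁ v₂) h rewrite decTree-node′ u₁ M u₂ eq lt le | eq with AllP.++⁻ u₁ h
    ... | h₁ , (pM ∷ h₂) = go u₁ v₁ h₁ , pM , go u₂ v₂ h₂

  Heap : BT ℕ → Set
  Heap leaf = ⊤
  Heap (node l a r) = AllBT (_≤ a) l × AllBT (_≤ a) r × Heap l × Heap r

  heap-decTree : ∀ w → Heap (decTree w)
  heap-decTree w = go w (decView w)
    where
    go : ∀ w → DecView w → Heap (decTree w)
    go w (dv-empty refl) = tt
    go w (dv-max u₁ M u₂ eq lt le v₁ v₂) rewrite decTree-node′ u₁ M u₂ eq lt le =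
      All-decTree u₁ (All.map <⇒≤ lt) , All-decTree u₂ le , go u₁ v₁ , go u₂ v₂

  take-++ˡ : ∀ {A : Set} k (xs ys : List A) → k ≤ length xs → take k (xs ++ ys) ≡ take k xs
  take-++ˡ zero xs ys h = refl
  take-++ˡ (suc k) (x ∷ xs) ys (s≤s h) = cong (x ∷_) (take-++ˡ k xs ys h)

  drop-++ˡ : ∀ {A : Set} k (xs ys : List A) → k ≤ length xs → drop k (xs ++ ys) ≡ drop k xs ++ ys
  drop-++ˡ zero xs ys h = refl
  drop-++ˡ (suc k) (x ∷ xs) ys (s≤s h) = drop-++ˡ k xs ys h

  take-++ʳ : ∀ {A : Set} k (xs : List A) y ys → length xs < k →
    take k (xs ++ y ∷ ys) ≡ xs ++ y ∷ take (k ∸ length xs ∸ 1) ys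
  take-++ʳ (suc k) [] y ys h = refl
  take-++ʳ (suc k) (x ∷ xs) y ys (s≤s h) = cong (x ∷_) (take-++ʳ k xs y ys h)

  drop-++ʳ : ∀ {A : Set} k (xs : List A) y ys → length xs < k →
    drop k (xs ++ y ∷ ys) ≡ drop (k ∸ length xs ∸ 1) ys
  drop-++ʳ (suc k) [] y ys h = refl
  drop-++ʳ (suc k) (x ∷ xs) y ys (s≤s h) = drop-++ʳ k xs y ys h

  split-decTree : ∀ k w → split1 k (decTree w) ≡ (decTree (take k w) , decTree (drop k w))
  split-decTree k w = go k w (decView w)
    where
    go : ∀ k w → DecView w → split1 k (decTree w) ≡ (decTree (take k w) , decTree (drop k w))
    go k w (dv-empty refl) rewrite take-[] {A = ℕ} k | drop-[] {A = ℕ} k = refl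
    go k w (dv-max u₁ M u₂ refl lt le v₁ v₂) rewrite decTree-node u₁ M u₂ lt le with ≤-<-connex k (size (decTree u₁))
    ... | inj₁ h rewrite split-≤ k (decTree u₁) M (decTree u₂) h | go k u₁ v₁
           | take-++ˡ k u₁ (M ∷ u₂) (subst (k ≤_) (size-decTree u₁) h)
           | drop-++ˡ k u₁ (M ∷ u₂) (subst (k ≤_) (size-decTree u₁) h)
           | decTree-node (drop k u₁) M u₂ (AllP.drop⁺ k lt) le = refl
    ... | inj₂ h = begin
        split1 k (node (decTree u₁) M (decTree u₂))
          ≡⟨ split-> k (decTree u₁) M (decTree u₂) h ⟩
        (node (decTree u₁) M (proj₁ (split1 (k ∸ size (decTree u₁) ∸ 1) (decTree u₂))) , proj₂ (split1 (k ∸ size (decTree u₁) ∸ 1) (decTree u₂)))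
          ≡⟨ cong (λ z → (node (decTree u₁) M (proj₁ (split1 (k ∸ z ∸ 1) (decTree u₂))) , proj₂ (split1 (k ∸ z ∸ 1) (decTree u₂)))) (size-decTree u₁) ⟩
        (node (decTree u₁) M (proj₁ (split1 k′ (decTree u₂))) , proj₂ (split1 k′ (decTree u₂)))
          ≡⟨ cong (λ z → (node (decTree u₁) M (proj₁ z) , proj₂ z)) (go k′ u₂ v₂) ⟩
        (node (decTree u₁) M (decTree (take k′ u₂)) , decTree (drop k′ u₂))
          ≡⟨ cong₂ _,_ (sym (decTree-node u₁ M (take k′ u₂) lt (AllP.take⁺ k′ le))) refl ⟩
        (decTree (u₁ ++ M ∷ take k′ u₂) , decTree (drop k′ u₂))
          ≡⟨ cong₂ (λ a b → (decTree a , decTree b)) (sym (take-++ʳ k u₁ M u₂ k>u₁)) (sym (drop-++ʳ k u₁ M u₂ k>u₁)) ⟩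
        (decTree (take k (u₁ ++ M ∷ u₂)) , decTree (drop k (u₁ ++ M ∷ u₂))) ∎
      where
      open ≡-Reasoning
      k′ = k ∸ length u₁ ∸ 1
      k>u₁ : length u₁ < k
      k>u₁ = subst (_< k) (size-decTree u₁) h

  firstOr : ℕ → BT ℕ → ℕ
  firstOr d leaf = d
  firstOr d (node l a r) = firstOr a l

  first : BT ℕ → ℕ
  first = firstOr 0

  first-decTree : ∀ x w d → firstOr d (decTree (x ∷ w)) ≡ x
  first-decTree x w d = go (x ∷ w) (decView (x ∷ w)) x w refl d
    where
    ∷-head : ∀ {a b : ℕ} {as bs : List ℕ} → a ∷ as ≡ b ∷ bs → a ≡ b
    ∷-head refl = refl
    go : ∀ w → DecView w → ∀ x w′ → w ≡ x ∷ w′ → ∀ d → firstOr d (decTree w) ≡ x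
    go w (dv-empty refl) x w′ () d
    go w (dv-max [] M u₂ refl lt le v₁ v₂) x w′ eq d =
      trans (cong (firstOr d) (decTree-node [] M u₂ lt le)) (∷-head eq)
    go w (dv-max (y ∷ u₁) M u₂ refl lt le v₁ v₂) x w′ eq d =
      trans (cong (firstOr d) (decTree-node (y ∷ u₁) M u₂ lt le)) (trans (go (y ∷ u₁) v₁ y u₁ refl M) (∷-head eq))

  decTree-shift : ∀ q w → decTree (map (q +_) w) ≡ mapBT (q +_) (decTree w)
  decTree-shift q w = go w (decView w)
    where
    go : ∀ w → DecView w → decTree (map (q +_) w) ≡ mapBT (q +_) (decTree w)
    go w (dv-empty refl) = refl
    go w (dv-max u₁ M u₂ refl lt le v₁ v₂)
      rewrite decTree-node u₁ M u₂ lt le | map-++ (q +_) u₁ (M ∷ u₂)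
            | decTree-node (map (q +_) u₁) (q + M) (map (q +_) u₂)
                (AllP.map⁺ (All.map (+-monoʳ-< q) lt)) (AllP.map⁺ (All.map (+-monoʳ-≤ q) le))
            | go u₁ v₁ | go u₂ v₂ = refl


-- The shuffle product
-- is associative up to reordering (shuffle-assoc), the ingredient (A) of the
-- plan; shuffles-split describes the shuffles of A with B₁ ++ y ∷ B₂ by the
-- number k of letters of A placed before y; this is the word-level shadow of
-- graftings-node.
module Shuffle where

  open PermLemmas
  open import Data.Nat using (ℕ; suc)
  open import Data.Product using (_,_)
  open import Data.Sum using (inj₁; inj₂)
  open import Data.List using (List; []; _∷_; [_]; _++_; map; concatMap; length; take; drop; upTo)
  open import Data.List.Properties using (++-identityʳ; ++-assoc; map-∘; concatMap-cong; concatMap-++; map-++; map-upTo)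
  open import Data.List.Membership.Propositional using (_∈_)
  open import Data.List.Membership.Propositional.Properties using (∈-map⁻; ∈-++⁻)
  open import Data.List.Relation.Unary.Any using (here)
  open import Data.List.Relation.Unary.All using (All)
  import Data.List.Relation.Unary.All.Properties as AllP
  open import Data.List.Relation.Binary.Permutation.Propositional
    using (_↭_; ↭-refl; ↭-sym; ↭-trans; module PermutationReasoning)
  import Data.List.Relation.Binary.Permutation.Propositional.Properties as PermP
  open import Relation.Binary.PropositionalEquality using (_≡_; refl; sym; trans; cong; cong₂)

  shuffles-[]ʳ : ∀ A → shuffles A [] ≡ [ A ]
  shuffles-[]ʳ [] = refl
  shuffles-[]ʳ (x ∷ A) = refl

  shuffle3ˡ shuffle3ʳ : List ℕ → List ℕ → List ℕ → List (List ℕ)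
  shuffle3ˡ A B C = concatMap (λ u → shuffles u C) (shuffles A B)
  shuffle3ʳ A B C = concatMap (λ v → shuffles A v) (shuffles B C)

  ++-exchange : ∀ {X : Set} (b c e f : List X) → (b ++ c) ++ (e ++ f) ↭ b ++ (e ++ (c ++ f))
  ++-exchange b c e f = begin
      (b ++ c) ++ (e ++ f) ≡⟨ ++-assoc b c (e ++ f) ⟩
      b ++ (c ++ (e ++ f)) ↭⟨ PermP.++⁺ˡ b (PermP.shifts c e) ⟩
      b ++ (e ++ (c ++ f)) ∎
    where open PermutationReasoning

  ++-interchange : ∀ {X : Set} (a b c d : List X) → (a ++ b) ++ (c ++ d) ↭ (a ++ c) ++ (b ++ d)
  ++-interchange a b c d = begin
      (a ++ b) ++ (c ++ d) ≡⟨ ++-assoc a b (c ++ d) ⟩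
      a ++ (b ++ (c ++ d)) ↭⟨ PermP.++⁺ˡ a (PermP.shifts b c) ⟩
      a ++ (c ++ (b ++ d)) ≡⟨ sym (++-assoc a c (b ++ d)) ⟩
      (a ++ c) ++ (b ++ d) ∎
    where open PermutationReasoning

  -- both bracketings satisfy the same recursion: sort the shuffles of
  -- a ∷ A, b ∷ B, c ∷ C by their first letter
  shuffle3ˡ-∷ : ∀ a A b B c C → shuffle3ˡ (a ∷ A) (b ∷ B) (c ∷ C) ↭
    map (a ∷_) (shuffle3ˡ A (b ∷ B) (c ∷ C)) ++ (map (b ∷_) (shuffle3ˡ (a ∷ A) B (c ∷ C)) ++ map (c ∷_) (shuffle3ˡ (a ∷ A) (b ∷ B) C))
  shuffle3ˡ-∷ a A b B c C = begin
      concatMap g (map (a ∷_) X ++ map (b ∷_) Y)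
        ≡⟨ trans (concatMap-++ g (map (a ∷_) X) (map (b ∷_) Y)) (cong₂ _++_ (concatMap-map g (a ∷_) X) (concatMap-map g (b ∷_) Y)) ⟩
      concatMap (λ u → map (a ∷_) (shuffles u (c ∷ C)) ++ map (c ∷_) (shuffles (a ∷ u) C)) X
        ++ concatMap (λ u → map (b ∷_) (shuffles u (c ∷ C)) ++ map (c ∷_) (shuffles (b ∷ u) C)) Y
        ↭⟨ PermP.++⁺ (concatMap-++-split (λ u → map (a ∷_) (shuffles u (c ∷ C))) (λ u → map (c ∷_) (shuffles (a ∷ u) C)) X)
                     (concatMap-++-split (λ u → map (b ∷_) (shuffles u (c ∷ C))) (λ u → map (c ∷_) (shuffles (b ∷ u) C)) Y) ⟩
      (aX ++ cX) ++ (bY ++ cY)   ↭⟨ ++-exchange aX cX bY cY ⟩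
      aX ++ (bY ++ (cX ++ cY))
        ≡⟨ cong₂ (λ p q → p ++ (q ++ (cX ++ cY))) (sym (map-concatMap (a ∷_) g X)) (sym (map-concatMap (b ∷_) g Y)) ⟩
      map (a ∷_) (shuffle3ˡ A (b ∷ B) (c ∷ C)) ++ (map (b ∷_) (shuffle3ˡ (a ∷ A) B (c ∷ C)) ++ (cX ++ cY))
        ≡⟨ cong (λ z → map (a ∷_) (shuffle3ˡ A (b ∷ B) (c ∷ C)) ++ (map (b ∷_) (shuffle3ˡ (a ∷ A) B (c ∷ C)) ++ z)) c-first ⟩
      map (a ∷_) (shuffle3ˡ A (b ∷ B) (c ∷ C)) ++ (map (b ∷_) (shuffle3ˡ (a ∷ A) B (c ∷ C)) ++ map (c ∷_) (shuffle3ˡ (a ∷ A) (b ∷ B) C)) ∎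
    where
    open PermutationReasoning
    g = λ u → shuffles u (c ∷ C)
    g′ = λ u → shuffles u C
    X = shuffles A (b ∷ B)
    Y = shuffles (a ∷ A) B
    aX = concatMap (λ u → map (a ∷_) (shuffles u (c ∷ C))) X
    cX = concatMap (λ u → map (c ∷_) (shuffles (a ∷ u) C)) X
    bY = concatMap (λ u → map (b ∷_) (shuffles u (c ∷ C))) Y
    cY = concatMap (λ u → map (c ∷_) (shuffles (b ∷ u) C)) Y
    c-first : cX ++ cY ≡ map (c ∷_) (shuffle3ˡ (a ∷ A) (b ∷ B) C)
    c-first = sym (trans (cong (map (c ∷_)) (concatMap-++ g′ (map (a ∷_) X) (map (b ∷_) Y)))
      (trans (map-++ (c ∷_) (concatMap g′ (map (a ∷_) X)) (concatMap g′ (map (b ∷_) Y)))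
        (cong₂ _++_ (trans (cong (map (c ∷_)) (concatMap-map g′ (a ∷_) X)) (map-concatMap (c ∷_) (λ u → shuffles (a ∷ u) C) X))
                    (trans (cong (map (c ∷_)) (concatMap-map g′ (b ∷_) Y)) (map-concatMap (c ∷_) (λ u → shuffles (b ∷ u) C) Y)))))

  shuffle3ʳ-∷ : ∀ a A b B c C → shuffle3ʳ (a ∷ A) (b ∷ B) (c ∷ C) ↭
    map (a ∷_) (shuffle3ʳ A (b ∷ B) (c ∷ C)) ++ (map (b ∷_) (shuffle3ʳ (a ∷ A) B (c ∷ C)) ++ map (c ∷_) (shuffle3ʳ (a ∷ A) (b ∷ B) C))
  shuffle3ʳ-∷ a A b B c C = begin
      concatMap h (map (b ∷_) X ++ map (c ∷_) Y)
        ≡⟨ trans (concatMap-++ h (map (b ∷_) X) (map (c ∷_) Y)) (cong₂ _++_ (concatMap-map h (b ∷_) X) (concatMap-map h (c ∷_) Y)) ⟩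
      concatMap (λ v → map (a ∷_) (shuffles A (b ∷ v)) ++ map (b ∷_) (shuffles (a ∷ A) v)) X
        ++ concatMap (λ v → map (a ∷_) (shuffles A (c ∷ v)) ++ map (c ∷_) (shuffles (a ∷ A) v)) Y
        ↭⟨ PermP.++⁺ (concatMap-++-split (λ v → map (a ∷_) (shuffles A (b ∷ v))) (λ v → map (b ∷_) (shuffles (a ∷ A) v)) X)
                     (concatMap-++-split (λ v → map (a ∷_) (shuffles A (c ∷ v))) (λ v → map (c ∷_) (shuffles (a ∷ A) v)) Y) ⟩
      (aX ++ bX) ++ (aY ++ cY)   ↭⟨ ++-interchange aX bX aY cY ⟩
      (aX ++ aY) ++ (bX ++ cY)
        ≡⟨ cong₂ _++_ (sym a-first) (cong₂ _++_ (sym (map-concatMap (b ∷_) h X)) (sym (map-concatMap (c ∷_) h Y))) ⟩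
      map (a ∷_) (shuffle3ʳ A (b ∷ B) (c ∷ C)) ++ (map (b ∷_) (shuffle3ʳ (a ∷ A) B (c ∷ C)) ++ map (c ∷_) (shuffle3ʳ (a ∷ A) (b ∷ B) C)) ∎
    where
    open PermutationReasoning
    h = λ v → shuffles (a ∷ A) v
    h′ = λ v → shuffles A v
    X = shuffles B (c ∷ C)
    Y = shuffles (b ∷ B) C
    aX = concatMap (λ v → map (a ∷_) (shuffles A (b ∷ v))) X
    bX = concatMap (λ v → map (b ∷_) (shuffles (a ∷ A) v)) X
    aY = concatMap (λ v → map (a ∷_) (shuffles A (c ∷ v))) Y
    cY = concatMap (λ v → map (c ∷_) (shuffles (a ∷ A) v)) Y
    a-first : map (a ∷_) (shuffle3ʳ A (b ∷ B) (c ∷ C)) ≡ aX ++ aY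
    a-first = trans (cong (map (a ∷_)) (concatMap-++ h′ (map (b ∷_) X) (map (c ∷_) Y)))
      (trans (map-++ (a ∷_) (concatMap h′ (map (b ∷_) X)) (concatMap h′ (map (c ∷_) Y)))
        (cong₂ _++_ (trans (cong (map (a ∷_)) (concatMap-map h′ (b ∷_) X)) (map-concatMap (a ∷_) (λ v → shuffles A (b ∷ v)) X))
                    (trans (cong (map (a ∷_)) (concatMap-map h′ (c ∷_) Y)) (map-concatMap (a ∷_) (λ v → shuffles A (c ∷ v)) Y))))

  shuffle-assoc : ∀ A B C → shuffle3ˡ A B C ↭ shuffle3ʳ A B C
  shuffle-assoc [] B C = ≡⇒↭ (trans (++-identityʳ (shuffles B C)) (sym (concatMap-pure (shuffles B C))))
  shuffle-assoc (a ∷ A) [] C = ↭-refl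
  shuffle-assoc (a ∷ A) (b ∷ B) [] =
    ≡⇒↭ (trans (concatMap-cong shuffles-[]ʳ (shuffles (a ∷ A) (b ∷ B))) (trans (concatMap-pure _) (sym (++-identityʳ _))))
  shuffle-assoc (a ∷ A) (b ∷ B) (c ∷ C) = ↭-trans (shuffle3ˡ-∷ a A b B c C)
    (↭-trans (PermP.++⁺ (PermP.map⁺ (a ∷_) (shuffle-assoc A (b ∷ B) (c ∷ C)))
             (PermP.++⁺ (PermP.map⁺ (b ∷_) (shuffle-assoc (a ∷ A) B (c ∷ C)))
                        (PermP.map⁺ (c ∷_) (shuffle-assoc (a ∷ A) (b ∷ B) C))))
      (↭-sym (shuffle3ʳ-∷ a A b B c C)))

  upTo-suc : ∀ n → upTo (suc n) ≡ 0 ∷ map suc (upTo n)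
  upTo-suc n = cong (0 ∷_) (sym (map-upTo suc n))

  module ShuffleThroughLetter (y : ℕ) (B₂ : List ℕ) where

    around : List ℕ → List ℕ → List (List ℕ)
    around A′ u₁ = map (λ u₂ → u₁ ++ y ∷ u₂) (shuffles A′ B₂)

    around-∷ : ∀ a A′ u₁ → map (a ∷_) (around A′ u₁) ≡ around A′ (a ∷ u₁)
    around-∷ a A′ u₁ = sym (map-∘ (shuffles A′ B₂))

    -- the shuffles of A with B₁ ++ y ∷ B₂ having exactly k letters of A before y
    shufflesCut : List ℕ → List ℕ → ℕ → List (List ℕ)
    shufflesCut A B₁ k = concatMap (around (drop k A)) (shuffles (take k A) B₁)

    shufflesThrough : List ℕ → List ℕ → List (List ℕ)
    shufflesThrough A B₁ = concatMap (shufflesCut A B₁) (upTo (suc (length A)))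

    shufflesThrough-∷ : ∀ a A B₁ → shufflesThrough (a ∷ A) B₁ ≡
      shufflesCut (a ∷ A) B₁ 0 ++ concatMap (λ k → shufflesCut (a ∷ A) B₁ (suc k)) (upTo (suc (length A)))
    shufflesThrough-∷ a A B₁ = trans (cong (concatMap (shufflesCut (a ∷ A) B₁)) (upTo-suc (suc (length A))))
      (cong (shufflesCut (a ∷ A) B₁ 0 ++_) (concatMap-map (shufflesCut (a ∷ A) B₁) suc (upTo (suc (length A)))))

    -- a shuffle placing k + 1 letters of a ∷ A before y starts with a or with
    -- the first letter of B₁
    shufflesCut-suc : ∀ a A b B₁ k →
      map (a ∷_) (shufflesCut A (b ∷ B₁) k) ++ map (b ∷_) (shufflesCut (a ∷ A) B₁ (suc k)) ≡ shufflesCut (a ∷ A) (b ∷ B₁) (suc k)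
    shufflesCut-suc a A b B₁ k = sym (trans (concatMap-++ F (map (a ∷_) S₁) (map (b ∷_) S₂))
      (cong₂ _++_ (trans (concatMap-map F (a ∷_) S₁) (trans (concatMap-cong (λ u → sym (around-∷ a (drop k A) u)) S₁) (sym (map-concatMap (a ∷_) F S₁))))
                  (trans (concatMap-map F (b ∷_) S₂) (trans (concatMap-cong (λ u → sym (around-∷ b (drop k A) u)) S₂) (sym (map-concatMap (b ∷_) F S₂))))))
      where
      F = around (drop k A)
      S₁ = shuffles (take k A) (b ∷ B₁)
      S₂ = shuffles (a ∷ take k A) B₁

    shuffles-split : ∀ A B₁ → shuffles A (B₁ ++ y ∷ B₂) ↭ shufflesThrough A B₁
    shuffles-split [] B₁ = ≡⇒↭ (sym (trans (++-identityʳ _) (++-identityʳ _)))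
    shuffles-split (a ∷ A) [] = begin
        map (a ∷_) (shuffles A (y ∷ B₂)) ++ map (y ∷_) (shuffles (a ∷ A) B₂)   ↭⟨ PermP.++⁺ʳ _ (PermP.map⁺ (a ∷_) (shuffles-split A [])) ⟩
        map (a ∷_) (shufflesThrough A []) ++ map (y ∷_) (shuffles (a ∷ A) B₂)  ↭⟨ PermP.++-comm (map (a ∷_) (shufflesThrough A [])) _ ⟩
        map (y ∷_) (shuffles (a ∷ A) B₂) ++ map (a ∷_) (shufflesThrough A [])  ≡⟨ cong₂ _++_ (sym (++-identityʳ _)) a-first ⟩
        shufflesCut (a ∷ A) [] 0 ++ concatMap (λ k → shufflesCut (a ∷ A) [] (suc k)) (upTo (suc (length A)))
          ≡⟨ sym (shufflesThrough-∷ a A []) ⟩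
        shufflesThrough (a ∷ A) [] ∎
      where
      open PermutationReasoning
      cut-suc : ∀ k → map (a ∷_) (shufflesCut A [] k) ≡ shufflesCut (a ∷ A) [] (suc k)
      cut-suc k = trans (cong (λ z → map (a ∷_) (concatMap (around (drop k A)) z)) (shuffles-[]ʳ (take k A)))
        (trans (map-++ (a ∷_) (around (drop k A) (take k A)) []) (cong (_++ []) (around-∷ a (drop k A) (take k A))))
      a-first : map (a ∷_) (shufflesThrough A []) ≡ concatMap (λ k → shufflesCut (a ∷ A) [] (suc k)) (upTo (suc (length A)))
      a-first = trans (map-concatMap (a ∷_) (shufflesCut A []) (upTo (suc (length A)))) (concatMap-cong cut-suc (upTo (suc (length A))))
    shuffles-split (a ∷ A) (b ∷ B₁) = begin
        map (a ∷_) (shuffles A (b ∷ B₁ ++ y ∷ B₂)) ++ map (b ∷_) (shuffles (a ∷ A) (B₁ ++ y ∷ B₂))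
          ↭⟨ PermP.++⁺ (PermP.map⁺ (a ∷_) (shuffles-split A (b ∷ B₁))) (PermP.map⁺ (b ∷_) (shuffles-split (a ∷ A) B₁)) ⟩
        map (a ∷_) (shufflesThrough A (b ∷ B₁)) ++ map (b ∷_) (shufflesThrough (a ∷ A) B₁)
          ≡⟨ cong (map (a ∷_) (shufflesThrough A (b ∷ B₁)) ++_)
                  (trans (cong (map (b ∷_)) (shufflesThrough-∷ a A B₁)) (map-++ (b ∷_) (shufflesCut (a ∷ A) B₁ 0) _)) ⟩
        map (a ∷_) (shufflesThrough A (b ∷ B₁)) ++ (map (b ∷_) (shufflesCut (a ∷ A) B₁ 0) ++ map (b ∷_) later)
          ↭⟨ PermP.shifts (map (a ∷_) (shufflesThrough A (b ∷ B₁))) (map (b ∷_) (shufflesCut (a ∷ A) B₁ 0)) ⟩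
        map (b ∷_) (shufflesCut (a ∷ A) B₁ 0) ++ (map (a ∷_) (shufflesThrough A (b ∷ B₁)) ++ map (b ∷_) later)
          ≡⟨ cong₂ _++_ b-first (cong₂ _++_ (map-concatMap (a ∷_) (shufflesCut A (b ∷ B₁)) U)
                                             (map-concatMap (b ∷_) (λ k → shufflesCut (a ∷ A) B₁ (suc k)) U)) ⟩
        shufflesCut (a ∷ A) (b ∷ B₁) 0 ++ (concatMap (λ k → map (a ∷_) (shufflesCut A (b ∷ B₁) k)) U
                                           ++ concatMap (λ k → map (b ∷_) (shufflesCut (a ∷ A) B₁ (suc k))) U)
          ↭⟨ PermP.++⁺ˡ (shufflesCut (a ∷ A) (b ∷ B₁) 0)
               (↭-sym (concatMap-++-split (λ k → map (a ∷_) (shufflesCut A (b ∷ B₁) k)) (λ k → map (b ∷_) (shufflesCut (a ∷ A) B₁ (suc k))) U)) ⟩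
        shufflesCut (a ∷ A) (b ∷ B₁) 0 ++ concatMap (λ k → map (a ∷_) (shufflesCut A (b ∷ B₁) k) ++ map (b ∷_) (shufflesCut (a ∷ A) B₁ (suc k))) U
          ≡⟨ cong (shufflesCut (a ∷ A) (b ∷ B₁) 0 ++_) (concatMap-cong (shufflesCut-suc a A b B₁) U) ⟩
        shufflesCut (a ∷ A) (b ∷ B₁) 0 ++ concatMap (λ k → shufflesCut (a ∷ A) (b ∷ B₁) (suc k)) U
          ≡⟨ sym (shufflesThrough-∷ a A (b ∷ B₁)) ⟩
        shufflesThrough (a ∷ A) (b ∷ B₁) ∎
      where
      open PermutationReasoning
      U = upTo (suc (length A))
      later = concatMap (λ k → shufflesCut (a ∷ A) B₁ (suc k)) U
      b-first : map (b ∷_) (shufflesCut (a ∷ A) B₁ 0) ≡ shufflesCut (a ∷ A) (b ∷ B₁) 0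
      b-first = trans (map-++ (b ∷_) (around (a ∷ A) B₁) []) (cong (_++ []) (around-∷ b (a ∷ A) B₁))

  shuffles-↭ : ∀ A B {u} → u ∈ shuffles A B → u ↭ A ++ B
  shuffles-↭ [] B (here refl) = ↭-refl
  shuffles-↭ (x ∷ A) [] (here refl) = ≡⇒↭ (sym (++-identityʳ (x ∷ A)))
  shuffles-↭ (x ∷ A) (y ∷ B) u∈ with ∈-++⁻ (map (x ∷_) (shuffles A (y ∷ B))) u∈
  ... | inj₁ p with ∈-map⁻ (x ∷_) p
  ...   | u′ , u′∈ , refl = _↭_.prep x (shuffles-↭ A (y ∷ B) u′∈)
  shuffles-↭ (x ∷ A) (y ∷ B) u∈ | inj₂ p with ∈-map⁻ (y ∷_) p
  ...   | u′ , u′∈ , refl = ↭-trans (_↭_.prep y (shuffles-↭ (x ∷ A) B u′∈)) (↭-sym (PermP.shift y (x ∷ A) B))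

  shuffles-All : ∀ {P : ℕ → Set} A B {u} → u ∈ shuffles A B → All P A → All P B → All P u
  shuffles-All A B u∈ pa pb = PermP.All-resp-↭ (↭-sym (shuffles-↭ A B u∈)) (AllP.++⁺ pa pb)

  map-shuffles : ∀ (f : ℕ → ℕ) A B → map (map f) (shuffles A B) ≡ shuffles (map f A) (map f B)
  map-shuffles f [] B = refl
  map-shuffles f (x ∷ A) [] = refl
  map-shuffles f (x ∷ A) (y ∷ B) = trans (map-++ (map f) (map (x ∷_) (shuffles A (y ∷ B))) _)
    (cong₂ _++_ (trans (head-map x (shuffles A (y ∷ B))) (cong (map (f x ∷_)) (map-shuffles f A (y ∷ B))))
                (trans (head-map y (shuffles (x ∷ A) B)) (cong (map (f y ∷_)) (map-shuffles f (x ∷ A) B))))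
    where
    head-map : ∀ z (S : List (List ℕ)) → map (map f) (map (z ∷_) S) ≡ map (f z ∷_) (map (map f) S)
    head-map z S = trans (sym (map-∘ S)) (map-∘ S)


module Relabel where

  open Splitting using (split-≤; split->)
  open DecTree using (AllBT; firstOr)
  open import Data.Nat using (ℕ; suc; _+_; _∸_; _≤_; _<_)
  open import Data.Nat.Properties using (≤-<-connex; 1+n≢0; +-suc)
  open import Data.Product using (_×_; _,_; proj₁; proj₂)
  open import Data.Sum using (inj₁; inj₂)
  open import Data.Unit using (tt)
  open import Data.Empty using (⊥-elim)
  open import Data.List using (List; []; _∷_; map)
  open import Data.List.Relation.Unary.All using (All; []; _∷_)
  open import Relation.Binary.PropositionalEquality using (_≡_; refl; sym; trans; cong; cong₂; subst)

  module _ {A B : Set} where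
    size-mapBT : ∀ (f : A → B) t → size (mapBT f t) ≡ size t
    size-mapBT f leaf = refl
    size-mapBT f (node l a r) = cong₂ (λ x y → x + suc y) (size-mapBT f l) (size-mapBT f r)

    split-mapBT : ∀ (f : A → B) i t →
      split1 i (mapBT f t) ≡ (mapBT f (proj₁ (split1 i t)) , mapBT f (proj₂ (split1 i t)))
    split-mapBT f i leaf = refl
    split-mapBT f i (node l a r) with ≤-<-connex i (size l)
    ... | inj₁ h rewrite split-≤ i l a r h | split-≤ i (mapBT f l) (f a) (mapBT f r) (subst (i ≤_) (sym (size-mapBT f l)) h)
                       | split-mapBT f i l = refl
    ... | inj₂ h rewrite split-> i l a r h | split-> i (mapBT f l) (f a) (mapBT f r) (subst (_< i) (sym (size-mapBT f l)) h)
                       | size-mapBT f l | split-mapBT f (i ∸ size l ∸ 1) r = refl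

    pSplit-mapBT : ∀ (f : A → B) o is t → pSplitFrom o is (mapBT f t) ≡ map (mapBT f) (pSplitFrom o is t)
    pSplit-mapBT f o [] t = refl
    pSplit-mapBT f o (i ∷ is) t rewrite split-mapBT f (i ∸ o) t = cong (_ ∷_) (pSplit-mapBT f i is _)

    graftAux-mapBT : ∀ (f : A → B) s ts →
      graftAux (mapBT f s) (map (mapBT f) ts) ≡ (mapBT f (proj₁ (graftAux s ts)) , map (mapBT f) (proj₂ (graftAux s ts)))
    graftAux-mapBT f leaf [] = refl
    graftAux-mapBT f leaf (t ∷ ts) = refl
    graftAux-mapBT f (node l a r) ts rewrite graftAux-mapBT f l ts | graftAux-mapBT f r (proj₂ (graftAux l ts)) = refl

    graft-mapBT : ∀ (f : A → B) ts s → mapBT f (graft ts s) ≡ graft (map (mapBT f) ts) (mapBT f s)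
    graft-mapBT f ts s = sym (cong proj₁ (graftAux-mapBT f s ts))

  mapBT-∘ : ∀ {A B C : Set} (g : B → C) (f : A → B) t → mapBT g (mapBT f t) ≡ mapBT (λ x → g (f x)) t
  mapBT-∘ g f leaf = refl
  mapBT-∘ g f (node l a r) = cong₂ (λ x y → node x (g (f a)) y) (mapBT-∘ g f l) (mapBT-∘ g f r)

  mapBT-cong : ∀ {A B : Set} {P : A → Set} (f g : A → B) t → AllBT P t → (∀ x → P x → f x ≡ g x) → mapBT f t ≡ mapBT g t
  mapBT-cong f g leaf _ h = refl
  mapBT-cong f g (node l a r) (pl , pa , pr) h rewrite mapBT-cong f g l pl h | h a pa | mapBT-cong f g r pr h = refl

  mapBT-cong′ : ∀ {A B : Set} (f g : A → B) t → (∀ x → f x ≡ g x) → mapBT f t ≡ mapBT g t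
  mapBT-cong′ f g leaf h = refl
  mapBT-cong′ f g (node l a r) h rewrite mapBT-cong′ f g l h | h a | mapBT-cong′ f g r h = refl

  module _ {A : Set} {P : A → Set} where
    All-split : ∀ i (t : BT A) → AllBT P t → AllBT P (proj₁ (split1 i t)) × AllBT P (proj₂ (split1 i t))
    All-split i leaf _ = tt , tt
    All-split i (node l a r) (pl , pa , pr) with ≤-<-connex i (size l)
    ... | inj₁ h rewrite split-≤ i l a r h = proj₁ (All-split i l pl) , (proj₂ (All-split i l pl) , pa , pr)
    ... | inj₂ h rewrite split-> i l a r h = (pl , pa , proj₁ (All-split _ r pr)) , proj₂ (All-split _ r pr)

    All-pSplit : ∀ o is (t : BT A) → AllBT P t → All (AllBT P) (pSplitFrom o is t)
    All-pSplit o [] t p = p ∷ []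
    All-pSplit o (i ∷ is) t p = proj₁ (All-split (i ∸ o) t p) ∷ All-pSplit i is _ (proj₂ (All-split (i ∸ o) t p))

  size0⇒leaf : ∀ {A : Set} (t : BT A) → size t ≡ 0 → t ≡ leaf
  size0⇒leaf leaf _ = refl
  size0⇒leaf (node l a r) e = ⊥-elim (1+n≢0 (trans (sym (+-suc (size l) (size r))) e))

  first-graft : ∀ d s t₀ ts → firstOr d (proj₁ (graftAux s (t₀ ∷ ts))) ≡ firstOr (firstOr d s) t₀
  first-graft d leaf t₀ ts = refl
  first-graft d (node l a r) t₀ ts = first-graft a l t₀ ts

  first-split : ∀ d k t → firstOr d t ≡ firstOr (firstOr d (proj₂ (split1 k t))) (proj₁ (split1 k t))
  first-split d k leaf = refl
  first-split d k (node l a r) with ≤-<-connex k (size l)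
  ... | inj₁ h rewrite split-≤ k l a r h = first-split a k l
  ... | inj₂ h rewrite split-> k l a r h = refl

  firstOr-nonempty : ∀ d d′ t → 0 < size t → firstOr d t ≡ firstOr d′ t
  firstOr-nonempty d d′ (node l a r) _ = refl

  firstOr-All : ∀ {P : ℕ → Set} d t → AllBT P t → P d → P (firstOr d t)
  firstOr-All d leaf _ pd = pd
  firstOr-All d (node l a r) (pl , pa , pr) pd = firstOr-All a l pl pa

  first-All : ∀ {P : ℕ → Set} d t → AllBT P t → 0 < size t → P (firstOr d t)
  first-All d (node l a r) (pl , pa , pr) _ = firstOr-All a l pl pa

  firstOr-map : ∀ (f : ℕ → ℕ) d t → firstOr (f d) (mapBT f t) ≡ f (firstOr d t)
  firstOr-map f d leaf = refl
  firstOr-map f d (node l a r) = firstOr-map f a l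


-- On decreasing trees β is
-- βT: circle every node whose label is at least the label of the leftmost
-- node.  If every letter of A is at most q < every letter of B, the decreasing
-- trees of the shuffles of A and B are the graftings of the splittings of
-- decTree A onto decTree B (decTree-shuffles), and βT of such a grafting is
-- the circled grafting of βT's (βT-graft): the leftmost node comes from the
-- first piece of the splitting when it is nonempty, and from decTree B otherwise.
module BetaProduct where

  open PermLemmas
  open Grafting
  open DecTree
  open Shuffle
  open Relabel
  open import Data.Bool using (true; false; T)
  open import Data.Nat using (ℕ; zero; suc; _+_; _≤_; _<_; _≤?_; z≤n; s≤s; _≤ᵇ_)
  open import Data.Nat.Properties
  open import Data.Product using (_×_; _,_; proj₁; proj₂)
  open import Data.Unit using (tt)
  open import Data.List using (List; []; _∷_; _++_; map; concatMap; length; take; drop; upTo)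
  open import Data.List.Properties using (map-∘; map-cong; concatMap-cong; map-cong-local)
  open import Data.List.Relation.Unary.All using (All; _∷_)
  import Data.List.Relation.Unary.All as All
  import Data.List.Relation.Unary.All.Properties as AllP
  open import Data.List.Membership.Propositional using (_∈_)
  open import Data.List.Relation.Binary.Permutation.Propositional using (_↭_; ↭-sym; module PermutationReasoning)
  import Data.List.Relation.Binary.Permutation.Propositional.Properties as PermP
  open import Relation.Nullary using (yes; no; contradiction)
  open import Relation.Binary.PropositionalEquality using (_≡_; refl; sym; trans; cong; cong₂; subst; module ≡-Reasoning)

  βT : BT ℕ → CTree
  βT t = mapBT (λ v → first t ≤ᵇ v) t

  β-βT : ∀ w → β w ≡ βT (decTree w)
  β-βT [] = refl
  β-βT (x ∷ w) = cong (λ z → mapBT (λ v → z ≤ᵇ v) (decTree (x ∷ w))) (sym (first-decTree x w 0))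

  graftCircled-empty : ∀ b₀ bs s → size b₀ ≡ 0 → graftCircled (b₀ ∷ bs) s ≡ graft (map (mapBT (λ _ → false)) (b₀ ∷ bs)) s
  graftCircled-empty b₀ bs s e rewrite e = refl

  graftCircled-nonempty : ∀ b₀ bs s n → size b₀ ≡ suc n → graftCircled (b₀ ∷ bs) s ≡ graft (b₀ ∷ bs) (mapBT (λ _ → true) s)
  graftCircled-nonempty b₀ bs s n e rewrite e = refl

  ≤ᵇ-true : ∀ {m n} → m ≤ n → (m ≤ᵇ n) ≡ true
  ≤ᵇ-true {m} {n} h with m ≤ᵇ n | ≤⇒≤ᵇ h
  ... | true | _ = refl

  ≤ᵇ-false : ∀ {m n} → n < m → (m ≤ᵇ n) ≡ false
  ≤ᵇ-false {m} {n} h with m ≤ᵇ n in eq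
  ... | false = refl
  ... | true = contradiction (≤ᵇ⇒≤ m n (subst T (sym eq) tt)) (<⇒≱ h)

  -- first piece empty: the leftmost node comes from s, whose labels exceed all
  -- labels of t, so no node of t gets circled
  βT-graft-fromRight : ∀ q t s i is → AllBT (_≤ q) t → AllBT (q <_) s → 0 < size s →
    size (proj₁ (split1 i t)) ≡ 0 → βT (graft (pSplit (i ∷ is) t) s) ≡ graftCircled (pSplit (i ∷ is) (βT t)) (βT s)
  βT-graft-fromRight q t s i is pt ps s>0 t₀-empty = begin
      βT (graft P s)                                                      ≡⟨ cong (λ z → mapBT (λ v → z ≤ᵇ v) (graft P s)) same-first ⟩
      mapBT g (graft P s)                                                 ≡⟨ graft-mapBT g P s ⟩
      graft (map (mapBT g) P) (mapBT g s)                                 ≡⟨ cong (λ z → graft z (mapBT g s)) uncircled ⟩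
      graft (map (mapBT (λ _ → false)) (map (mapBT f) P)) (βT s)
        ≡⟨ cong (λ z → graft (map (mapBT (λ _ → false)) z) (βT s)) (sym (pSplit-mapBT f 0 (i ∷ is) t)) ⟩
      graft (map (mapBT (λ _ → false)) (pSplit (i ∷ is) (βT t))) (βT s)
        ≡⟨ sym (graftCircled-empty _ _ (βT s) (trans (cong size (cong proj₁ (split-mapBT f i t))) (trans (size-mapBT f (proj₁ (split1 i t))) t₀-empty))) ⟩
      graftCircled (pSplit (i ∷ is) (βT t)) (βT s) ∎
    where
    open ≡-Reasoning
    P = pSplit (i ∷ is) t
    f = λ v → first t ≤ᵇ v
    g = λ v → first s ≤ᵇ v
    same-first : first (graft P s) ≡ first s
    same-first = trans (first-graft 0 s (proj₁ (split1 i t)) _) (cong (firstOr (first s)) (size0⇒leaf (proj₁ (split1 i t)) t₀-empty))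
    q<first : q < first s
    q<first = first-All 0 s ps s>0
    uncircled : map (mapBT g) P ≡ map (mapBT (λ _ → false)) (map (mapBT f) P)
    uncircled = trans (map-cong-local (All.map (λ {p} pp → trans (mapBT-cong g (λ _ → false) p pp (λ x x≤q → ≤ᵇ-false (≤-<-trans x≤q q<first)))
                                                                 (sym (mapBT-∘ (λ _ → false) f p)))
                                              (All-pSplit 0 (i ∷ is) t pt)))
                      (map-∘ P)

  -- first piece nonempty: the leftmost node comes from t, and every node of s
  -- carries a larger label, so all nodes of s get circled
  βT-graft-fromLeft : ∀ q t s i is n → AllBT (_≤ q) t → AllBT (q <_) s →
    size (proj₁ (split1 i t)) ≡ suc n → βT (graft (pSplit (i ∷ is) t) s) ≡ graftCircled (pSplit (i ∷ is) (βT t)) (βT s)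
  βT-graft-fromLeft q t s i is n pt ps t₀-size = begin
      βT (graft P s)                                               ≡⟨ cong (λ z → mapBT (λ v → z ≤ᵇ v) (graft P s)) same-first ⟩
      mapBT f (graft P s)                                          ≡⟨ graft-mapBT f P s ⟩
      graft (map (mapBT f) P) (mapBT f s)                          ≡⟨ cong₂ graft (sym (pSplit-mapBT f 0 (i ∷ is) t)) circled ⟩
      graft (pSplit (i ∷ is) (βT t)) (mapBT (λ _ → true) (βT s))
        ≡⟨ sym (graftCircled-nonempty _ _ (βT s) n (trans (cong size (cong proj₁ (split-mapBT f i t))) (trans (size-mapBT f t₀) t₀-size))) ⟩
      graftCircled (pSplit (i ∷ is) (βT t)) (βT s) ∎
    where
    open ≡-Reasoning
    P = pSplit (i ∷ is) t
    f = λ v → first t ≤ᵇ v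
    t₀ = proj₁ (split1 i t)
    t₀>0 : 0 < size t₀
    t₀>0 = subst (0 <_) (sym t₀-size) (s≤s z≤n)
    first-t : first t ≡ firstOr 0 t₀
    first-t = trans (first-split 0 i t) (firstOr-nonempty _ 0 t₀ t₀>0)
    same-first : first (graft P s) ≡ first t
    same-first = trans (first-graft 0 s t₀ _) (trans (firstOr-nonempty _ 0 t₀ t₀>0) (sym first-t))
    first≤q : first t ≤ q
    first≤q = subst (_≤ q) (sym first-t) (first-All 0 t₀ (proj₁ (All-split i t pt)) t₀>0)
    circled : mapBT f s ≡ mapBT (λ _ → true) (βT s)
    circled = trans (mapBT-cong f (λ _ → true) s ps (λ x q<x → ≤ᵇ-true (≤-trans first≤q (<⇒≤ q<x)))) (sym (mapBT-∘ (λ _ → true) _ s))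

  βT-graft : ∀ q t s is → AllBT (_≤ q) t → AllBT (q <_) s → length is ≡ size s →
    βT (graft (pSplit is t) s) ≡ graftCircled (pSplit is (βT t)) (βT s)
  βT-graft q leaf s [] pt ps e rewrite size0⇒leaf s (sym e) = refl
  βT-graft q (node l a r) s [] pt ps e rewrite size0⇒leaf s (sym e) =
    sym (graftCircled-nonempty (βT (node l a r)) [] leaf (size l + size r) (trans (size-mapBT _ (node l a r)) (+-suc (size l) (size r))))
  βT-graft q t s (i ∷ is) pt ps e with size (proj₁ (split1 i t)) in t₀-size
  ... | zero = βT-graft-fromRight q t s i is pt ps (subst (0 <_) e (s≤s z≤n)) t₀-size
  ... | suc n = βT-graft-fromLeft q t s i is n pt ps t₀-size

  decTree-shufflesCut : ∀ A B₁ M B₂ k → All (_< M) A → All (_< M) B₁ → All (_≤ M) B₂ →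
    map decTree (ShuffleThroughLetter.shufflesCut M B₂ A B₁ k)
      ≡ nodes M (map decTree (shuffles (take k A) B₁)) (map decTree (shuffles (drop k A) B₂))
  decTree-shufflesCut A B₁ M B₂ k A<M B₁<M B₂≤M = begin
      map decTree (concatMap (ShuffleThroughLetter.around M B₂ (drop k A)) S₁)
        ≡⟨ map-concatMap decTree _ S₁ ⟩
      concatMap (λ u₁ → map decTree (ShuffleThroughLetter.around M B₂ (drop k A) u₁)) S₁
        ≡⟨ concatMap-cong-local S₁ (λ {u₁} u₁∈ → trans (sym (map-∘ S₂)) (map-cong-∈ S₂ (λ u₂∈ → decTree-node u₁ M _ (lt u₁∈) (le u₂∈)))) ⟩
      concatMap (λ u₁ → map (λ u₂ → node (decTree u₁) M (decTree u₂)) S₂) S₁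
        ≡⟨ concatMap-cong (λ u₁ → map-∘ S₂) S₁ ⟩
      concatMap (λ u₁ → map (λ y → node (decTree u₁) M y) (map decTree S₂)) S₁
        ≡⟨ sym (concatMap-map (λ x → map (λ y → node x M y) (map decTree S₂)) decTree S₁) ⟩
      nodes M (map decTree S₁) (map decTree S₂) ∎
    where
    open ≡-Reasoning
    S₁ = shuffles (take k A) B₁
    S₂ = shuffles (drop k A) B₂
    lt : ∀ {u₁} → u₁ ∈ S₁ → All (_< M) u₁
    lt u₁∈ = shuffles-All (take k A) B₁ u₁∈ (AllP.take⁺ k A<M) B₁<M
    le : ∀ {u₂} → u₂ ∈ S₂ → All (_≤ M) u₂
    le u₂∈ = shuffles-All (drop k A) B₂ u₂∈ (All.map <⇒≤ (AllP.drop⁺ k A<M)) B₂≤M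

  decTree-shuffles : ∀ q A B → All (_≤ q) A → All (q <_) B → ∀ o →
    map decTree (shuffles A B) ↭ graftings o (decTree A) (decTree B)
  decTree-shuffles q A B pa pb o = go B (decView B) A pa pb o
    where
    go : ∀ B → DecView B → ∀ A → All (_≤ q) A → All (q <_) B → ∀ o → map decTree (shuffles A B) ↭ graftings o (decTree A) (decTree B)
    go B (dv-empty refl) A pa pb o = ≡⇒↭ (cong (map decTree) (shuffles-[]ʳ A))
    go B (dv-max B₁ M B₂ refl lt le v₁ v₂) A pa pb o with AllP.++⁻ B₁ pb
    ... | pb₁ , (q<M ∷ pb₂) = begin
        map decTree (shuffles A (B₁ ++ M ∷ B₂))
          ↭⟨ PermP.map⁺ decTree (ShuffleThroughLetter.shuffles-split M B₂ A B₁) ⟩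
        map decTree (ShuffleThroughLetter.shufflesThrough M B₂ A B₁)
          ≡⟨ trans (map-concatMap decTree (ShuffleThroughLetter.shufflesCut M B₂ A B₁) U)
                   (concatMap-cong (λ k → decTree-shufflesCut A B₁ M B₂ k A<M lt le) U) ⟩
        concatMap (λ k → nodes M (map decTree (shuffles (take k A) B₁)) (map decTree (shuffles (drop k A) B₂))) U
          ↭⟨ concatMap-↭ U (λ k → nodes-↭ M (go B₁ v₁ (take k A) (AllP.take⁺ k pa) pb₁ o)
                                            (go B₂ v₂ (drop k A) (AllP.drop⁺ k pa) pb₂ (o + k))) ⟩
        concatMap (λ k → graftPieces k (decTree (take k A) , decTree (drop k A))) U
          ≡⟨ trans (cong (λ z → concatMap (λ k → graftPieces k (decTree (take k A) , decTree (drop k A))) (upTo (suc z))) (sym (size-decTree A)))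
                   (concatMap-cong (λ k → cong (graftPieces k) (sym (split-decTree k A))) (upTo (suc (size (decTree A))))) ⟩
        concatMap (λ k → graftPieces k (split1 k (decTree A))) (upTo (suc (size (decTree A))))
          ↭⟨ ↭-sym (graftings-node o (decTree A) (decTree B₁) M (decTree B₂)) ⟩
        graftings o (decTree A) (node (decTree B₁) M (decTree B₂))
          ≡⟨ cong (graftings o (decTree A)) (sym (decTree-node B₁ M B₂ lt le)) ⟩
        graftings o (decTree A) (decTree (B₁ ++ M ∷ B₂)) ∎
      where
      open PermutationReasoning
      U = upTo (suc (length A))
      graftPieces : ℕ → BT ℕ × BT ℕ → List (BT ℕ)
      graftPieces k p = nodes M (graftings o (proj₁ p) (decTree B₁)) (graftings (o + k) (proj₂ p) (decTree B₂))
      A<M : All (_< M) A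
      A<M = All.map (λ x≤q → ≤-<-trans x≤q q<M) pa

  ≤ᵇ-shift : ∀ q a b → ((q + a) ≤ᵇ (q + b)) ≡ (a ≤ᵇ b)
  ≤ᵇ-shift q a b with a ≤? b
  ... | yes h = trans (≤ᵇ-true (+-monoʳ-≤ q h)) (sym (≤ᵇ-true h))
  ... | no h = trans (≤ᵇ-false (+-monoʳ-< q (≰⇒> h))) (sym (≤ᵇ-false (≰⇒> h)))

  βT-shift : ∀ q t → βT (mapBT (q +_) t) ≡ βT t
  βT-shift q leaf = refl
  βT-shift q (node l a r) =
    trans (cong (λ z → mapBT (λ v → z ≤ᵇ v) (mapBT (q +_) (node l a r))) (firstOr-map (q +_) a l))
          (trans (mapBT-∘ _ (q +_) (node l a r)) (mapBT-cong′ _ _ (node l a r) (≤ᵇ-shift q (firstOr a l))))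

  β-product : ∀ σ ρ → All (_≤ length σ) σ → All (1 ≤_) ρ → map β (permProd σ ρ) ↭ treeProd (β σ) (β ρ)
  β-product σ ρ σ≤q 1≤ρ = begin
      map β (shuffles σ B)                                              ≡⟨ trans (map-cong β-βT (shuffles σ B)) (map-∘ (shuffles σ B)) ⟩
      map βT (map decTree (shuffles σ B))                               ↭⟨ PermP.map⁺ βT (decTree-shuffles q σ B σ≤q q<B 0) ⟩
      map βT (graftings 0 (decTree σ) (decTree B))                      ≡⟨ sym (map-∘ splittingSeqs) ⟩
      map (λ is → βT (graft (pSplit is (decTree σ)) (decTree B))) splittingSeqs
        ≡⟨ map-cong-∈ splittingSeqs (λ {is} m → βT-graft q (decTree σ) (decTree B) is (All-decTree σ σ≤q) (All-decTree B q<B)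
                                                   (proj₂ (ndSeqs-mem (size (decTree B)) 0 (size (decTree σ)) m))) ⟩
      map (λ is → graftCircled (pSplit is (βT (decTree σ))) (βT (decTree B))) splittingSeqs ≡⟨ as-treeProd ⟩
      treeProd (β σ) (β ρ) ∎
    where
    open PermutationReasoning
    q = length σ
    B = map (q +_) ρ
    splittingSeqs = ndSeqs (size (decTree B)) 0 (size (decTree σ))
    q<B : All (q <_) B
    q<B = AllP.map⁺ (All.map (λ {x} 1≤x → subst (_≤ q + x) (+-comm q 1) (+-monoʳ-≤ q 1≤x)) 1≤ρ)
    βρ : β ρ ≡ βT (decTree B)
    βρ = trans (β-βT ρ) (trans (sym (βT-shift q (decTree ρ))) (cong βT (sym (decTree-shift q ρ))))
    as-treeProd : map (λ is → graftCircled (pSplit is (βT (decTree σ))) (βT (decTree B))) splittingSeqs ≡ treeProd (β σ) (β ρ)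
    as-treeProd rewrite βρ | β-βT σ | size-mapBT (λ v → first (decTree σ) ≤ᵇ v) (decTree σ)
                       | size-mapBT (λ v → first (decTree B) ≤ᵇ v) (decTree B) = map-∘ splittingSeqs


-- For σ = x ∷ w, β σ circles the nodes of the heap
-- decTree σ with label ≥ x: this set is closed under parents (heap order),
-- contains the leftmost node (label x), and the right child of that node is
-- uncircled since its labels are the letters after x in the prefix before the
-- next larger letter, all < x.
module BetaBasis where

  open PermLemmas
  open DecTree
  open Shuffle
  open Relabel
  open BetaProduct
  open import Data.Bool using (Bool; T)
  open import Data.Nat using (ℕ; zero; suc; _+_; _≤_; _<_; z≤n; s≤s; _≤ᵇ_)
  open import Data.Nat.Properties
  open import Data.Product using (_×_; _,_; proj₁)
  open import Data.Sum using (inj₁; inj₂)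
  open import Data.Unit using (tt)
  open import Data.List using (List; []; _∷_; _++_; map; length; upTo)
  open import Data.List.Properties using (map-∘; map-cong; length-map; length-++)
  open import Data.List.Relation.Unary.All using (All; []; _∷_)
  import Data.List.Relation.Unary.All as All
  open import Data.List.Relation.Unary.Any using (here; there)
  import Data.List.Relation.Unary.All.Properties as AllP
  open import Data.List.Relation.Unary.AllPairs using ([]; _∷_)
  open import Data.List.Relation.Unary.Unique.Propositional using (Unique)
  open import Data.List.Membership.Propositional using (_∈_)
  open import Data.List.Relation.Binary.Permutation.Propositional using (_↭_; prep; swap; ↭-sym; ↭-trans)
  import Data.List.Relation.Binary.Permutation.Propositional.Properties as PermP
  open import Relation.Nullary using (¬_)
  open import Relation.Binary.PropositionalEquality
    using (_≡_; _≢_; refl; sym; trans; cong; cong₂; subst; module ≡-Reasoning)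

  unique-resp-↭ : ∀ {xs ys : List ℕ} → xs ↭ ys → Unique xs → Unique ys
  unique-resp-↭ _↭_.refl u = u
  unique-resp-↭ (prep x p) (a ∷ u) = PermP.All-resp-↭ p a ∷ unique-resp-↭ p u
  unique-resp-↭ (swap x y p) ((x≢y ∷ ax) ∷ (ay ∷ u)) =
    ((λ e → x≢y (sym e)) ∷ PermP.All-resp-↭ p ay) ∷ (PermP.All-resp-↭ p ax ∷ unique-resp-↭ p u)
  unique-resp-↭ (_↭_.trans p q) u = unique-resp-↭ q (unique-resp-↭ p u)

  interval : ℕ → ℕ → List ℕ
  interval b zero = []
  interval b (suc n) = suc b ∷ interval (suc b) n

  interval-++ : ∀ b m n → interval b (m + n) ≡ interval b m ++ interval (b + m) n
  interval-++ b zero n = cong (λ z → interval z n) (sym (+-identityʳ b))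
  interval-++ b (suc m) n =
    cong (suc b ∷_) (trans (interval-++ (suc b) m n) (cong (λ z → interval (suc b) m ++ interval z n) (sym (+-suc b m))))

  interval-upTo : ∀ n → map suc (upTo n) ≡ interval 0 n
  interval-upTo n = go 0 n
    where
    go : ∀ b n → map (λ i → b + suc i) (upTo n) ≡ interval b n
    go b zero = refl
    go b (suc n) = begin
        map (λ i → b + suc i) (upTo (suc n))                ≡⟨ cong (map (λ i → b + suc i)) (upTo-suc n) ⟩
        b + 1 ∷ map (λ i → b + suc i) (map suc (upTo n))    ≡⟨ cong₂ _∷_ (trans (+-suc b 0) (cong suc (+-identityʳ b)))
                                                                         (trans (sym (map-∘ (upTo n))) (map-cong (λ i → +-suc b (suc i)) (upTo n))) ⟩
        suc b ∷ map (λ i → suc b + suc i) (upTo n)          ≡⟨ cong (suc b ∷_) (go (suc b) n) ⟩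
        interval b (suc n) ∎
      where open ≡-Reasoning

  interval-shift : ∀ q b n → map (q +_) (interval b n) ≡ interval (q + b) n
  interval-shift q b zero = refl
  interval-shift q b (suc n) = cong₂ _∷_ (+-suc q b) (trans (interval-shift q (suc b) n) (cong (λ z → interval z n) (+-suc q b)))

  interval-mem : ∀ b n {x} → x ∈ interval b n → b < x × x ≤ b + n
  interval-mem b (suc n) (here refl) = s≤s ≤-refl , subst (suc b ≤_) (sym (+-suc b n)) (s≤s (m≤m+n b n))
  interval-mem b (suc n) (there m) with interval-mem (suc b) n m
  ... | lo , hi = <-trans (s≤s ≤-refl) lo , subst (_≤_ _) (sym (+-suc b n)) hi

  interval-unique : ∀ b n → Unique (interval b n)
  interval-unique b zero = []
  interval-unique b (suc n) = All.tabulate (λ m e → <⇒≢ (proj₁ (interval-mem (suc b) n m)) e) ∷ interval-unique (suc b) n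

  perm⇒interval : ∀ {w} → IsPerm w → w ↭ interval 0 (length w)
  perm⇒interval {w} p = ↭-trans p (≡⇒↭ (interval-upTo (length w)))

  interval⇒perm : ∀ {w} → w ↭ interval 0 (length w) → IsPerm w
  interval⇒perm {w} p = ↭-trans p (≡⇒↭ (sym (interval-upTo (length w))))

  perm-range : ∀ {w} → IsPerm w → All (λ x → 1 ≤ x × x ≤ length w) w
  perm-range {w} p = PermP.All-resp-↭ (↭-sym (perm⇒interval p)) (All.tabulate (λ m → interval-mem 0 (length w) m))

  perm-unique : ∀ {w} → IsPerm w → Unique w
  perm-unique {w} p = unique-resp-↭ (↭-sym (perm⇒interval p)) (interval-unique 0 (length w))

  shuffle-perm : ∀ σ ρ {u} → IsPerm σ → IsPerm ρ → u ∈ permProd σ ρ → IsPerm u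
  shuffle-perm σ ρ {u} pσ pρ m = interval⇒perm (↭-trans u↭ (≡⇒↭ (cong (interval 0) (sym len))))
    where
    q = length σ
    p = length ρ
    u↭ : u ↭ interval 0 (q + p)
    u↭ = ↭-trans (shuffles-↭ σ (map (q +_) ρ) m)
         (↭-trans (PermP.++⁺ (perm⇒interval pσ) (↭-trans (PermP.map⁺ (q +_) (perm⇒interval pρ))
                                                          (≡⇒↭ (trans (interval-shift q 0 p) (cong (λ z → interval z p) (+-identityʳ q))))))
         (≡⇒↭ (sym (interval-++ 0 q p))))
    len : length u ≡ q + p
    len = trans (PermP.↭-length (shuffles-↭ σ (map (q +_) ρ) m)) (trans (length-++ σ) (cong (q +_) (length-map (q +_) ρ)))

  module CircleFrom (x : ℕ) where
    circled : ℕ → Bool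
    circled v = x ≤ᵇ v

    circled-mono : ∀ {b a} → T (circled b) → b ≤ a → T (circled a)
    circled-mono {b} {a} h b≤a = ≤⇒≤ᵇ (≤-trans (≤ᵇ⇒≤ x b h) b≤a)

    root-circled-mono : ∀ {a} t → AllBT (_≤ a) t → T (rootCircled (mapBT circled t)) → T (circled a)
    root-circled-mono (node l b r) (_ , b≤a , _) h = circled-mono h b≤a

    root-uncircled : ∀ t → AllBT (_< x) t → ¬ T (rootCircled (mapBT circled t))
    root-uncircled (node l b r) (_ , b<x , _) h rewrite ≤ᵇ-false b<x = h

    parentClosed : ∀ t → Heap t → ParentClosed (mapBT circled t)
    parentClosed leaf _ = tt
    parentClosed (node l a r) (hl , hr , Hl , Hr) =
      root-circled-mono l hl , root-circled-mono r hr , parentClosed l Hl , parentClosed r Hr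

    node1-lift : ∀ (t : CTree) c r → 0 < size t → Node1OK t → Node1OK (node t c r)
    node1-lift (node l a r′) c r _ h = h

    -- node 1 of decTree (x ∷ w) is labelled x, and its right subtree collects
    -- letters smaller than x, provided x does not recur in w
    node1OK : ∀ w₀ → DecView w₀ → ∀ w → w₀ ≡ x ∷ w → All (x ≢_) w → Node1OK (mapBT circled (decTree w₀))
    node1OK w₀ (dv-empty e₀) w e _ with trans (sym e₀) e
    ... | ()
    node1OK w₀ (dv-max [] M u₂ e₀ lt le v₁ v₂) w e fresh with trans (sym e₀) e
    ... | refl rewrite decTree-node′ [] x u₂ e₀ lt le =
      ≤⇒≤ᵇ (≤-refl {x}) ,
      root-uncircled (decTree u₂) (All-decTree u₂ (All.zipWith (λ (x≥y , x≢y) → ≤∧≢⇒< x≥y (λ e → x≢y (sym e))) (le , fresh)))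
    node1OK w₀ (dv-max (y ∷ u₁) M u₂ e₀ lt le v₁ v₂) w e fresh with trans (sym e₀) e
    ... | refl rewrite decTree-node′ (x ∷ u₁) M u₂ e₀ lt le =
      node1-lift (mapBT circled (decTree (x ∷ u₁))) (circled M) (mapBT circled (decTree u₂))
        (subst (0 <_) (sym (trans (size-mapBT circled (decTree (x ∷ u₁))) (size-decTree (x ∷ u₁)))) (s≤s z≤n))
        (node1OK (x ∷ u₁) v₁ u₁ refl (AllP.++⁻ˡ u₁ fresh))

  β-basis : ∀ w → IsPerm w → InMBasis (β w)
  β-basis [] _ = inj₁ refl
  β-basis (x ∷ w) p with perm-unique p
  ... | fresh ∷ _ = inj₂ (CircleFrom.node1OK x (x ∷ w) (decView (x ∷ w)) w refl fresh ,
                          CircleFrom.parentClosed x (decTree (x ∷ w)) (heap-decTree (x ∷ w)))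


-- Given a
-- bi-leveled tree t with m uncircled nodes, label the uncircled nodes by
-- 1, …, m and the circled ones by m + 1, …, n, each node receiving the largest
-- label of its kind in its subtree (labelling).  Parent-closedness makes the
-- labels strictly decrease downwards, so the in-order word σ of the labelling
-- has decTree σ = labelling (decTree-inorder); node 1 is circled and carries
-- the smallest circled label m + 1, so β σ circles exactly the circled nodes.
module BetaSurjective where

  open PermLemmas
  open DecTree
  open Shuffle using (++-interchange)
  open BetaProduct
  open BetaBasis
  open import Data.Bool using (true; false; T)
  open import Data.Nat using (ℕ; suc; _+_; _≤_; _<_; s≤s; _≤ᵇ_)
  open import Data.Nat.Properties
  open import Data.Nat.Solver using (module +-*-Solver)
  open +-*-Solver using (solve; _:+_; _:=_; con)
  open import Data.Product using (Σ; _×_; _,_)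
  open import Data.Sum using (inj₁; inj₂)
  open import Data.Unit using (⊤; tt)
  open import Data.Empty using (⊥-elim)
  open import Data.List using (List; []; _∷_; [_]; _++_; length)
  open import Data.List.Properties using (length-++; ++-assoc)
  open import Data.List.Relation.Unary.All using (All; []; _∷_)
  import Data.List.Relation.Unary.All.Properties as AllP
  open import Data.List.Relation.Binary.Permutation.Propositional using (_↭_; ↭-refl; ↭-sym; ↭-trans; module PermutationReasoning)
  import Data.List.Relation.Binary.Permutation.Propositional.Properties as PermP
  open import Relation.Nullary using (¬_)
  open import Relation.Binary.PropositionalEquality using (_≡_; refl; sym; trans; cong; cong₂)

  #u #c : CTree → ℕ
  #u leaf = 0
  #u (node l false r) = (#u l + #u r) + 1
  #u (node l true r) = #u l + #u r
  #c leaf = 0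
  #c (node l false r) = #c l + #c r
  #c (node l true r) = (#c l + #c r) + 1

  labelling : CTree → ℕ → ℕ → BT ℕ
  labelling leaf uB cB = leaf
  labelling (node l false r) uB cB = node (labelling l uB cB) (suc (uB + (#u l + #u r))) (labelling r (uB + #u l) (cB + #c l))
  labelling (node l true r) uB cB = node (labelling l uB cB) (suc (cB + (#c l + #c r))) (labelling r (uB + #u l) (cB + #c l))

  inorder : BT ℕ → List ℕ
  inorder leaf = []
  inorder (node l a r) = inorder l ++ a ∷ inorder r

  length-inorder : ∀ t → length (inorder t) ≡ size t
  length-inorder leaf = refl
  length-inorder (node l a r) = trans (length-++ (inorder l)) (cong₂ (λ x y → x + suc y) (length-inorder l) (length-inorder r))

  size-# : ∀ t → size t ≡ #u t + #c t
  size-# leaf = refl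
  size-# (node l false r) rewrite size-# l | size-# r =
    solve 4 (λ a b c d → (a :+ b) :+ (con 1 :+ (c :+ d)) := ((a :+ c) :+ con 1) :+ (b :+ d)) refl (#u l) (#c l) (#u r) (#c r)
  size-# (node l true r) rewrite size-# l | size-# r =
    solve 4 (λ a b c d → (a :+ b) :+ (con 1 :+ (c :+ d)) := (a :+ c) :+ ((b :+ d) :+ con 1)) refl (#u l) (#c l) (#u r) (#c r)

  size-labelling : ∀ t uB cB → size (labelling t uB cB) ≡ size t
  size-labelling leaf uB cB = refl
  size-labelling (node l false r) uB cB = cong₂ (λ x y → x + suc y) (size-labelling l uB cB) (size-labelling r _ _)
  size-labelling (node l true r) uB cB = cong₂ (λ x y → x + suc y) (size-labelling l uB cB) (size-labelling r _ _)

  All-inorder : ∀ {P : ℕ → Set} t → AllBT P t → All P (inorder t)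
  All-inorder leaf _ = []
  All-inorder (node l a r) (pl , pa , pr) = AllP.++⁺ (All-inorder l pl) (pa ∷ All-inorder r pr)

  StrictHeap : BT ℕ → Set
  StrictHeap leaf = ⊤
  StrictHeap (node l a r) = AllBT (_< a) l × AllBT (_< a) r × StrictHeap l × StrictHeap r

  AllBT-map : ∀ {P Q : ℕ → Set} t → (∀ {x} → P x → Q x) → AllBT P t → AllBT Q t
  AllBT-map leaf f _ = tt
  AllBT-map (node l a r) f (pl , pa , pr) = AllBT-map l f pl , f pa , AllBT-map r f pr

  decTree-inorder : ∀ t → StrictHeap t → decTree (inorder t) ≡ t
  decTree-inorder leaf _ = refl
  decTree-inorder (node l a r) (hl , hr , Hl , Hr) =
    trans (decTree-node (inorder l) a (inorder r) (All-inorder l hl) (All-inorder r (AllBT-map r <⇒≤ hr)))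
          (cong₂ (λ x y → node x a y) (decTree-inorder l Hl) (decTree-inorder r Hr))

  no-circled : ∀ t → ParentClosed t → ¬ T (rootCircled t) → #c t ≡ 0
  no-circled leaf _ _ = refl
  no-circled (node l true r) _ h = ⊥-elim (h tt)
  no-circled (node l false r) (cl , cr , pl , pr) _ = cong₂ _+_ (no-circled l pl cl) (no-circled r pr cr)

  ≤-left : ∀ b x y → b + x ≤ b + (x + y)
  ≤-left b x y = +-monoʳ-≤ b (m≤m+n x y)

  ≤-right : ∀ b x y → (b + x) + y ≤ b + (x + y)
  ≤-right b x y = ≤-reflexive (+-assoc b x y)

  top-label : ∀ b s → suc (b + s) ≡ b + (s + 1)
  top-label b s = trans (sym (+-suc b s)) (cong (b +_) (+-comm 1 s))

  labelling-bound-uncircled : ∀ t uB cB → #c t ≡ 0 → AllBT (_≤ uB + #u t) (labelling t uB cB)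
  labelling-bound-uncircled leaf uB cB _ = tt
  labelling-bound-uncircled (node l true r) uB cB e = ⊥-elim (1+n≢0 (trans (+-comm 1 _) e))
  labelling-bound-uncircled (node l false r) uB cB e =
    AllBT-map (labelling l uB cB) (λ h → ≤-trans h (≤-trans (≤-left uB (#u l) (#u r)) (≤-left uB _ 1)))
              (labelling-bound-uncircled l uB cB (m+n≡0⇒m≡0 (#c l) e)) ,
    ≤-reflexive (top-label uB _) ,
    AllBT-map (labelling r _ _) (λ h → ≤-trans h (≤-trans (≤-right uB (#u l) (#u r)) (≤-left uB _ 1)))
              (labelling-bound-uncircled r (uB + #u l) (cB + #c l) (m+n≡0⇒n≡0 (#c l) e))

  labelling-bound : ∀ t uB cB → uB + #u t ≤ cB → AllBT (_≤ cB + #c t) (labelling t uB cB)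
  labelling-bound leaf uB cB h = tt
  labelling-bound (node l false r) uB cB h =
    AllBT-map (labelling l uB cB) (λ z → ≤-trans z (≤-left cB (#c l) (#c r)))
              (labelling-bound l uB cB (≤-trans (≤-trans (≤-left uB (#u l) (#u r)) (≤-left uB _ 1)) h)) ,
    ≤-trans (≤-trans (≤-reflexive (top-label uB _)) h) (m≤m+n cB _) ,
    AllBT-map (labelling r _ _) (λ z → ≤-trans z (≤-right cB (#c l) (#c r)))
              (labelling-bound r (uB + #u l) (cB + #c l) (≤-trans (≤-trans (≤-right uB (#u l) (#u r)) (≤-trans (≤-left uB _ 1) h)) (m≤m+n cB (#c l))))
  labelling-bound (node l true r) uB cB h =
    AllBT-map (labelling l uB cB) (λ z → ≤-trans z (≤-trans (≤-left cB (#c l) (#c r)) (≤-left cB _ 1)))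
              (labelling-bound l uB cB (≤-trans (≤-left uB (#u l) (#u r)) h)) ,
    ≤-reflexive (top-label cB _) ,
    AllBT-map (labelling r _ _) (λ z → ≤-trans z (≤-trans (≤-right cB (#c l) (#c r)) (≤-left cB _ 1)))
              (labelling-bound r (uB + #u l) (cB + #c l) (≤-trans (≤-trans (≤-right uB (#u l) (#u r)) h) (m≤m+n cB (#c l))))

  -- for a parent-closed tree the labelling is a strict heap: below an uncircled
  -- node all labels are uncircled and smaller; below a circled node all labels
  -- are smaller circled ones or uncircled ones
  strictHeap-labelling : ∀ t uB cB → ParentClosed t → uB + #u t ≤ cB → StrictHeap (labelling t uB cB)
  strictHeap-labelling leaf uB cB _ _ = tt
  strictHeap-labelling (node l false r) uB cB (cl , cr , pl , pr) h =
    AllBT-map (labelling l uB cB) (λ z → s≤s (≤-trans z (≤-left uB (#u l) (#u r)))) (labelling-bound-uncircled l uB cB (no-circled l pl cl)) ,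
    AllBT-map (labelling r _ _) (λ z → s≤s (≤-trans z (≤-right uB (#u l) (#u r))))
              (labelling-bound-uncircled r (uB + #u l) (cB + #c l) (no-circled r pr cr)) ,
    strictHeap-labelling l uB cB pl (≤-trans (≤-trans (≤-left uB (#u l) (#u r)) (≤-left uB _ 1)) h) ,
    strictHeap-labelling r (uB + #u l) (cB + #c l) pr (≤-trans (≤-trans (≤-right uB (#u l) (#u r)) (≤-trans (≤-left uB _ 1) h)) (m≤m+n cB (#c l)))
  strictHeap-labelling (node l true r) uB cB (cl , cr , pl , pr) h =
    AllBT-map (labelling l uB cB) (λ z → s≤s (≤-trans z (≤-left cB (#c l) (#c r))))
              (labelling-bound l uB cB (≤-trans (≤-left uB (#u l) (#u r)) h)) ,
    AllBT-map (labelling r _ _) (λ z → s≤s (≤-trans z (≤-right cB (#c l) (#c r))))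
              (labelling-bound r (uB + #u l) (cB + #c l) (≤-trans (≤-trans (≤-right uB (#u l) (#u r)) h) (m≤m+n cB (#c l)))) ,
    strictHeap-labelling l uB cB pl (≤-trans (≤-left uB (#u l) (#u r)) h) ,
    strictHeap-labelling r (uB + #u l) (cB + #c l) pr (≤-trans (≤-trans (≤-right uB (#u l) (#u r)) h) (m≤m+n cB (#c l)))

  β-labelling : ∀ m t uB cB → uB + #u t ≤ m → m ≤ cB → mapBT (λ v → suc m ≤ᵇ v) (labelling t uB cB) ≡ t
  β-labelling m leaf uB cB _ _ = refl
  β-labelling m (node l false r) uB cB h1 h2
    rewrite β-labelling m l uB cB (≤-trans (≤-trans (≤-left uB (#u l) (#u r)) (≤-left uB _ 1)) h1) h2
          | β-labelling m r (uB + #u l) (cB + #c l) (≤-trans (≤-trans (≤-right uB (#u l) (#u r)) (≤-left uB _ 1)) h1) (≤-trans h2 (m≤m+n cB (#c l)))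
          | ≤ᵇ-false {suc m} {suc (uB + (#u l + #u r))} (s≤s (≤-trans (≤-reflexive (top-label uB _)) h1)) = refl
  β-labelling m (node l true r) uB cB h1 h2
    rewrite β-labelling m l uB cB (≤-trans (≤-left uB (#u l) (#u r)) h1) h2
          | β-labelling m r (uB + #u l) (cB + #c l) (≤-trans (≤-right uB (#u l) (#u r)) h1) (≤-trans h2 (m≤m+n cB (#c l)))
          | ≤ᵇ-true {suc m} {suc (cB + (#c l + #c r))} (s≤s (≤-trans h2 (m≤m+n cB _))) = refl

  -- node 1 is circled with no circled node below it: it gets the label cB + 1
  first-labelling : ∀ t uB cB d → Node1OK t → ParentClosed t → firstOr d (labelling t uB cB) ≡ suc cB
  first-labelling (node leaf true r) uB cB d (_ , nr) (_ , cr , _ , pr) rewrite no-circled r pr nr = cong suc (+-identityʳ cB)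
  first-labelling (node (node l₁ c₁ r₁) false r) uB cB d n1 (_ , _ , pl , _) = first-labelling (node l₁ c₁ r₁) uB cB _ n1 pl
  first-labelling (node (node l₁ c₁ r₁) true r) uB cB d n1 (_ , _ , pl , _) = first-labelling (node l₁ c₁ r₁) uB cB _ n1 pl

  ∷-to-middle : ∀ (x : ℕ) A C → x ∷ (A ++ C) ↭ (A ++ [ x ]) ++ C
  ∷-to-middle x A C = ↭-trans (↭-sym (PermP.shift x A C)) (≡⇒↭ (sym (++-assoc A [ x ] C)))

  ∷-to-end : ∀ (x : ℕ) A C → x ∷ (A ++ C) ↭ A ++ (C ++ [ x ])
  ∷-to-end x A C = ↭-trans (↭-sym (PermP.shift x A C)) (PermP.++⁺ˡ A (PermP.∷↭∷ʳ x C))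

  labelling-perm : ∀ t uB cB → inorder (labelling t uB cB) ↭ interval uB (#u t) ++ interval cB (#c t)
  labelling-perm leaf uB cB = ↭-refl
  labelling-perm (node l false r) uB cB = begin
      inorder (labelling l uB cB) ++ x ∷ inorder (labelling r (uB + #u l) (cB + #c l))
        ↭⟨ PermP.++⁺ (labelling-perm l uB cB) (_↭_.prep x (labelling-perm r _ _)) ⟩
      (A₁ ++ C₁) ++ x ∷ (A₂ ++ C₂) ↭⟨ PermP.shift x (A₁ ++ C₁) (A₂ ++ C₂) ⟩
      x ∷ ((A₁ ++ C₁) ++ (A₂ ++ C₂)) ↭⟨ _↭_.prep x (++-interchange A₁ C₁ A₂ C₂) ⟩
      x ∷ ((A₁ ++ A₂) ++ (C₁ ++ C₂)) ↭⟨ ∷-to-middle x (A₁ ++ A₂) (C₁ ++ C₂) ⟩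
      ((A₁ ++ A₂) ++ [ x ]) ++ (C₁ ++ C₂)
        ≡⟨ sym (cong₂ _++_ (trans (interval-++ uB (#u l + #u r) 1) (cong (_++ [ x ]) (interval-++ uB (#u l) (#u r)))) (interval-++ cB (#c l) (#c r))) ⟩
      interval uB ((#u l + #u r) + 1) ++ interval cB (#c l + #c r) ∎
    where
    open PermutationReasoning
    x = suc (uB + (#u l + #u r))
    A₁ = interval uB (#u l)
    C₁ = interval cB (#c l)
    A₂ = interval (uB + #u l) (#u r)
    C₂ = interval (cB + #c l) (#c r)
  labelling-perm (node l true r) uB cB = begin
      inorder (labelling l uB cB) ++ x ∷ inorder (labelling r (uB + #u l) (cB + #c l))
        ↭⟨ PermP.++⁺ (labelling-perm l uB cB) (_↭_.prep x (labelling-perm r _ _)) ⟩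
      (A₁ ++ C₁) ++ x ∷ (A₂ ++ C₂) ↭⟨ PermP.shift x (A₁ ++ C₁) (A₂ ++ C₂) ⟩
      x ∷ ((A₁ ++ C₁) ++ (A₂ ++ C₂)) ↭⟨ _↭_.prep x (++-interchange A₁ C₁ A₂ C₂) ⟩
      x ∷ ((A₁ ++ A₂) ++ (C₁ ++ C₂)) ↭⟨ ∷-to-end x (A₁ ++ A₂) (C₁ ++ C₂) ⟩
      (A₁ ++ A₂) ++ ((C₁ ++ C₂) ++ [ x ])
        ≡⟨ sym (cong₂ _++_ (interval-++ uB (#u l) (#u r)) (trans (interval-++ cB (#c l + #c r) 1) (cong (_++ [ x ]) (interval-++ cB (#c l) (#c r))))) ⟩
      interval uB (#u l + #u r) ++ interval cB ((#c l + #c r) + 1) ∎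
    where
    open PermutationReasoning
    x = suc (cB + (#c l + #c r))
    A₁ = interval uB (#u l)
    C₁ = interval cB (#c l)
    A₂ = interval (uB + #u l) (#u r)
    C₂ = interval (cB + #c l) (#c r)

  β-surjective : ∀ t → InMBasis t → Σ (List ℕ) λ σ → IsPerm σ × β σ ≡ t
  β-surjective t (inj₁ refl) = [] , ↭-refl , refl
  β-surjective t (inj₂ (n1 , pcl)) = σ , interval⇒perm pσ , eβ
    where
    m = #u t
    lab = labelling t 0 m
    σ = inorder lab
    len : length σ ≡ m + #c t
    len = trans (length-inorder lab) (trans (size-labelling t 0 m) (size-# t))
    pσ : σ ↭ interval 0 (length σ)
    pσ = ↭-trans (labelling-perm t 0 m) (≡⇒↭ (trans (sym (interval-++ 0 m (#c t))) (cong (interval 0) (sym len))))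
    eβ : β σ ≡ t
    eβ = trans (β-βT σ) (trans (cong βT (decTree-inorder lab (strictHeap-labelling t 0 m pcl (≤-reflexive refl))))
          (trans (cong (λ z → mapBT (λ v → z ≤ᵇ v) lab) (first-labelling t 0 m 0 n1 pcl)) (β-labelling m t 0 m ≤-refl ≤-refl)))


module BasisLevel where

  open PermLemmas
  open Shuffle
  open Relabel using (mapBT-∘)
  open BetaProduct using (β-product)
  open BetaBasis
  open BetaSurjective using (β-surjective)
  open import Data.Nat using (ℕ; _+_)
  open import Data.Nat.Properties using (+-assoc)
  open import Data.Product using (_×_; _,_; proj₁; proj₂)
  open import Data.Unit using (tt)
  open import Data.List using (List; []; _∷_; map; concatMap; length)
  open import Data.List.Properties using (map-∘; map-cong; length-++; length-map)
  open import Data.List.Relation.Unary.All using (All)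
  import Data.List.Relation.Unary.All as All
  import Data.List.Relation.Unary.All.Properties as AllP
  open import Data.List.Membership.Propositional using (_∈_)
  open import Data.List.Relation.Binary.Permutation.Propositional using (_↭_; ↭-sym; ↭-trans; module PermutationReasoning)
  import Data.List.Relation.Binary.Permutation.Propositional.Properties as PermP
  open import Relation.Binary.PropositionalEquality using (_≡_; refl; sym; trans; cong)

  β-product-perm : ∀ σ ρ → IsPerm σ → IsPerm ρ → map β (permProd σ ρ) ↭ treeProd (β σ) (β ρ)
  β-product-perm σ ρ pσ pρ = β-product σ ρ (All.map proj₂ (perm-range pσ)) (All.map proj₁ (perm-range pρ))

  -- associativity of the product F_σ · F_ρ of permutations, from (A): the
  -- shifts by |a| and |a| + |b| commute with shuffling
  permProd-assoc : ∀ a b π → concatMap (λ u → permProd u π) (permProd a b) ↭ concatMap (λ v → permProd a v) (permProd b π)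
  permProd-assoc a b π = begin
      concatMap (λ u → permProd u π) (shuffles a B)
        ≡⟨ concatMap-cong-local (shuffles a B) (λ {u} m → cong (λ z → shuffles u (map (z +_) π)) (length-shuffle m)) ⟩
      shuffle3ˡ a B C   ↭⟨ shuffle-assoc a B C ⟩
      shuffle3ʳ a B C   ≡⟨ cong (concatMap (shuffles a)) (sym shift-shuffles) ⟩
      concatMap (shuffles a) (map (map (qa +_)) (shuffles b (map (qb +_) π)))
        ≡⟨ concatMap-map (shuffles a) (map (qa +_)) (shuffles b (map (qb +_) π)) ⟩
      concatMap (λ v → permProd a v) (permProd b π) ∎
    where
    open PermutationReasoning
    qa = length a
    qb = length b
    B = map (qa +_) b
    C = map ((qa + qb) +_) π
    length-shuffle : ∀ {u} → u ∈ shuffles a B → length u ≡ qa + qb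
    length-shuffle m = trans (PermP.↭-length (shuffles-↭ a B m)) (trans (length-++ a) (cong (qa +_) (length-map (qa +_) b)))
    shift-shuffles : map (map (qa +_)) (shuffles b (map (qb +_) π)) ≡ shuffles B C
    shift-shuffles = trans (map-shuffles (qa +_) b (map (qb +_) π))
                           (cong (shuffles B) (trans (sym (map-∘ π)) (map-cong (λ x → sym (+-assoc qa qb x)) π)))

  action-assoc-basis : ∀ a b c → IsPerm a → IsPerm b → InMBasis c →
    concatMap (λ t → treeProd (β t) c) (permProd a b) ↭ concatMap (λ t → treeProd (β a) t) (treeProd (β b) c)
  action-assoc-basis a b c pa pb pc with β-surjective c pc
  ... | π , pπ , refl = begin
      concatMap (λ u → treeProd (β u) (β π)) (permProd a b)
        ↭⟨ concatMap-↭-local (permProd a b) (λ {u} m → ↭-sym (β-product-perm u π (shuffle-perm a b pa pb m) pπ)) ⟩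
      concatMap (λ u → map β (permProd u π)) (permProd a b)   ≡⟨ sym (map-concatMap β (λ u → permProd u π) (permProd a b)) ⟩
      map β (concatMap (λ u → permProd u π) (permProd a b))   ↭⟨ PermP.map⁺ β (permProd-assoc a b π) ⟩
      map β (concatMap (λ v → permProd a v) (permProd b π))   ≡⟨ map-concatMap β (λ v → permProd a v) (permProd b π) ⟩
      concatMap (λ v → map β (permProd a v)) (permProd b π)
        ↭⟨ concatMap-↭-local (permProd b π) (λ {v} m → β-product-perm a v pa (shuffle-perm b π pb pπ m)) ⟩
      concatMap (λ v → treeProd (β a) (β v)) (permProd b π)   ≡⟨ sym (concatMap-map (treeProd (β a)) β (permProd b π)) ⟩
      concatMap (treeProd (β a)) (map β (permProd b π))       ↭⟨ concatMap-resp-↭ (treeProd (β a)) (β-product-perm b π pb pπ) ⟩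
      concatMap (λ t → treeProd (β a) t) (treeProd (β b) (β π)) ∎
    where open PermutationReasoning

  -- associativity of the product of 𝓜Sym on basis elements: write a, b as β of
  -- permutations and reduce to the action
  product-assoc-basis : ∀ a b c → InMBasis a → InMBasis b → InMBasis c →
    concatMap (λ t → treeProd t c) (treeProd a b) ↭ concatMap (λ t → treeProd a t) (treeProd b c)
  product-assoc-basis a b c pa pb pc with β-surjective a pa | β-surjective b pb
  ... | σ , pσ , refl | ρ , pρ , refl =
    ↭-trans (concatMap-resp-↭ (λ t → treeProd t c) (↭-sym (β-product-perm σ ρ pσ pρ)))
            (↭-trans (≡⇒↭ (concatMap-map (λ t → treeProd t c) β (permProd σ ρ))) (action-assoc-basis σ ρ c pσ pρ pc))

  product-closed-basis : ∀ a s → InMBasis a → InMBasis s → All InMBasis (treeProd a s)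
  product-closed-basis a s pa ps with β-surjective a pa | β-surjective s ps
  ... | σ , pσ , refl | π , pπ , refl =
    PermP.All-resp-↭ (β-product-perm σ π pσ pπ) (AllP.map⁺ (All.tabulate (λ {u} m → β-basis u (shuffle-perm σ π pσ pπ m))))

  φ∘β : ∀ σ → φ (β σ) ≡ τ σ
  φ∘β [] = refl
  φ∘β (x ∷ w) = mapBT-∘ (λ _ → tt) _ (decTree (x ∷ w))

open import Data.Product using (_,_)
open import Data.List using (_∷_; [_])
open import Data.List.Properties using (++-identityʳ)
open import Data.List.Relation.Unary.All using (_∷_; [])
open Linear
open BasisLevel

mainTheorem1 : ∀ {c ℓ} (F : Field c ℓ) → CharZero F →
    let open Lin F in
    -- (i) the action is associative: (F_w · F_v) · x = F_w · (F_v · x)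
    (∀ (w v : List ℕ) → IsPerm w → IsPerm v → ∀ (x : MSym) → InMSym x →
       (((basis w ·S basis v) ▷ x) ≈M (basis w ▷ (basis v ▷ x))))
    -- (ii) the product on 𝓜Sym is a product on 𝓜Sym and is associative
    × (∀ (x y : MSym) → InMSym x → InMSym y → InMSym (x ·M y))
    × (∀ (x y z : MSym) → InMSym x → InMSym y → InMSym z →
         (((x ·M y) ·M z) ≈M (x ·M (y ·M z))))
    -- (iii) β is an algebra homomorphism and φ ∘ β = τ
    × (βL oneS ≈M oneM)
    × (∀ (x y : SSym) → InSSym x → InSSym y → (βL (x ·S y) ≈M (βL x ·M βL y)))
    × (∀ (x : SSym) → InSSym x → (φL (βL x) ≈Y τL x))
mainTheorem1 F _ =
    (λ w v pw pv x px → coeffs (action-assoc w v pw pv x px))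
  , (λ x y px py → bilin-closed treeProd InMBasis InMBasis InMBasis product-closed-basis x px y py)
  , (λ x y z px py pz → coeffs (bilin-assoc bt-≟ treeProd treeProd treeProd treeProd
                                  InMBasis InMBasis InMBasis product-assoc-basis x px y py z pz))
  , coeffs β-unit
  , (λ x y px py → coeffs (bilin-hom bt-≟ permProd treeProd β β β IsPerm IsPerm β-product-perm x px y py))
  , (λ x px → coeffs (linMap-comp tree-≟ β φ τ φ∘β x))
  where
  open Field F
  open Lin F
  open OverField F
  action-assoc : ∀ w v → IsPerm w → IsPerm v → (x : MSym) → InMSym x →
    CoeffEq bt-≟ ((basis w ·S basis v) ▷ x) (basis w ▷ (basis v ▷ x))
  action-assoc w v pw pv = bilin-assoc bt-≟ permProd (λ u s → treeProd (β u) s) (λ u s → treeProd (β u) s) (λ u s → treeProd (β u) s)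
                             IsPerm IsPerm InMBasis action-assoc-basis [ (1# , w) ] (pw ∷ []) [ (1# , v) ] (pv ∷ [])
  -- βL (F_∅) = 1·F_| with coefficient 1 · 1 = 1
  β-unit : CoeffEq bt-≟ (βL oneS) oneM
  β-unit = CoeffEq-trans bt-≟ (CoeffEq-≡ bt-≟ (++-identityʳ _)) (CoeffEq-scalar bt-≟ [ leaf ] (λ d → d) (1# * 1#) 1# (*-identityʳ 1#))
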